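{- Let $n,d$ be positive integers, $i\in[d]$, and let $\{v_1,\dots,v_n\}\subset\mathbb{Z}^d_{\ge0}$ be vectors each with sum of coordinates $n-1$ such that the $i$-th coordinates $(v_1)_i,\dots,(v_n)_i$ take all the values $0,1,\dots,n-1$ (an $i$-spread system). Then this system is spread-out, and it is realizable by some triangulation of $\Delta_{n-1}\times\Delta_{d-1}$.
   Context: Take $\Delta_{d-1}=\{x\in\mathbb{R}^d:\sum x_k=1,\ x_k\ge 0\}$. A fine mixed subdivision of $n\Delta_{d-1}$ is a polyhedral subdivision of $n\Delta_{d-1}$ into cells each given as an ordered Minkowski sum $B_1+\dots+B_n$ of faces of $\Delta_{d-1}$ with $\dim(\sum B_j)=\sum\dim B_j$, intersecting face to face in the labeled sense; these correspond bijectively (Cayley trick) to triangulations without new vertices of $\Delta_{n-1}\times\Delta_{d-1}$. For each $j\in[n]$ the unique cell whose $j$-th summand is $\Delta_{d-1}$ and other summands are vertices equals $v_j+\Delta_{d-1}$ with $v_j$ the sum of those vertices; $v_j$ is the position of the $j$-th unmixed simplex. A system $\{v_1,\dots,v_n\}$ is realizable if some fine mixed subdivision (triangulation) has these as the positions of its unmixed simplices, $v_j$ for label $j$. The system is spread-out if for every subset $S$ of $k$ of the vectors, $\sum_{m=1}^d\min_{v\in S}v_m\le n-k$.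
   Formalization: In the triangulation, the points of $\Delta_{n-1}\times\Delta_{d-1}$ and the coefficients of convex combinations and of affine dependences of its vertices are taken in ℚ. -}

module Defs where

open import Data.Nat as ℕ using (ℕ; zero; suc; _⊓_; _∸_)
open import Data.Bool using (Bool; true; false; if_then_else_; _∧_)
open import Data.Fin using (Fin; zero; suc; _≟_)
open import Data.Fin.Subset using (Subset; ∣_∣; Nonempty)
open import Data.Fin.Subset.Properties using (_∈?_)
open import Data.List using (List; []; _∷_; map; filter; foldr; allFin)
open import Data.List.Membership.Propositional using (_∈_)
open import Data.List.Relation.Unary.All using (All)
open import Data.List.Relation.Unary.Any using (Any)
open import Data.Rational using (ℚ; 0ℚ; 1ℚ; _+_; _≤_)
open import Data.Product using (Σ; ∃; _×_)
open import Relation.Binary.PropositionalEquality using (_≡_)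
open import Relation.Nullary.Decidable using (does)

sumℚ : ∀ {k} → (Fin k → ℚ) → ℚ
sumℚ {zero}  f = 0ℚ
sumℚ {suc k} f = f zero + sumℚ (λ i → f (suc i))

sumℕ : ∀ {k} → (Fin k → ℕ) → ℕ
sumℕ {zero}  f = 0
sumℕ {suc k} f = f zero ℕ.+ sumℕ (λ i → f (suc i))

-- Spread-out systems.  A system is an indexed family v : Fin n → ℕ^d
-- (v j m = m-th coordinate of v_(j+1)).

-- minimum of a list (only used on non-empty lists)
minList : List ℕ → ℕ
minList []       = 0
minList (x ∷ xs) = foldr _⊓_ x xs

valuesOn : ∀ {n} → Subset n → (Fin n → ℕ) → List ℕ
valuesOn {n} S f = map f (filter (λ j → j ∈? S) (allFin n))

SpreadOut : ∀ {n d} → (Fin n → Fin d → ℕ) → Set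
SpreadOut {n} {d} v =
  ∀ (S : Subset n) → Nonempty S →
    sumℕ (λ m → minList (valuesOn S (λ j → v j m))) ℕ.≤ n ∸ ∣ S ∣

-- Triangulations (without new vertices) of Δ_{n-1} × Δ_{d-1}.
-- Vertices are the pairs (j , m) ∈ Fin n × Fin d, i.e. the points
-- (e_j , e_m) ∈ ℝ^n × ℝ^d.  A simplex is a set of vertices.

VSet : ℕ → ℕ → Set
VSet n d = Fin n → Fin d → Bool

_∩ᵥ_ : ∀ {n d} → VSet n d → VSet n d → VSet n d
(σ ∩ᵥ τ) j m = σ j m ∧ τ j m

cardV : ∀ {n d} → VSet n d → ℕ
cardV σ = sumℕ (λ j → sumℕ (λ m → if σ j m then 1 else 0))

Weights : ℕ → ℕ → Set
Weights n d = Fin n → Fin d → ℚ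

rowSum : ∀ {n d} → Weights n d → Fin n → ℚ
rowSum w j = sumℚ (λ m → w j m)

colSum : ∀ {n d} → Weights n d → Fin d → ℚ
colSum w m = sumℚ (λ j → w j m)

totalW : ∀ {n d} → Weights n d → ℚ
totalW w = sumℚ (λ j → rowSum w j)

SupportedOn : ∀ {n d} → VSet n d → Weights n d → Set
SupportedOn σ w = ∀ j m → σ j m ≡ false → w j m ≡ 0ℚ

NonNeg : ∀ {n d} → Weights n d → Set
NonNeg w = ∀ j m → 0ℚ ≤ w j m

-- (p , q) ∈ ℚ^n × ℚ^d lies in conv σ: it is a convex combination of the
-- vertices (e_j , e_m) with (j , m) ∈ σ.
InHull : ∀ {n d} → VSet n d → (Fin n → ℚ) → (Fin d → ℚ) → Set
InHull {n} {d} σ p q =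
  Σ (Weights n d) λ w →
    NonNeg w × SupportedOn σ w × totalW w ≡ 1ℚ ×
    (∀ j → rowSum w j ≡ p j) × (∀ m → colSum w m ≡ q m)

InPolytope : ∀ {n d} → (Fin n → ℚ) → (Fin d → ℚ) → Set
InPolytope p q =
  (∀ j → 0ℚ ≤ p j) × sumℚ p ≡ 1ℚ × (∀ m → 0ℚ ≤ q m) × sumℚ q ≡ 1ℚ

AffinelyIndependent : ∀ {n d} → VSet n d → Set
AffinelyIndependent {n} {d} σ =
  ∀ (w : Weights n d) → SupportedOn σ w →
    (∀ j → rowSum w j ≡ 0ℚ) → (∀ m → colSum w m ≡ 0ℚ) →
    ∀ j m → w j m ≡ 0ℚ

MaxSimplex : ∀ {n d} → VSet n d → Set
MaxSimplex {n} {d} σ = AffinelyIndependent σ × cardV σ ≡ n ℕ.+ d ∸ 1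

-- A triangulation (without new vertices) of Δ_{n-1} × Δ_{d-1}, given by
-- its maximal simplices: they cover the polytope and any two intersect
-- in a common face (conv σ ∩ conv τ = conv (σ ∩ τ)).  Rational points
-- suffice since all polytopes involved are rational.
IsTriangulation : ∀ {n d} → List (VSet n d) → Set
IsTriangulation {n} {d} T =
  All MaxSimplex T ×
  (∀ p q → InPolytope {n} {d} p q → Any (λ σ → InHull σ p q) T) ×
  (∀ σ τ → σ ∈ T → τ ∈ T → ∀ p q → InHull σ p q → InHull τ p q →
     InHull (σ ∩ᵥ τ) p q)

-- Unmixed simplices (via the Cayley trick).  The mixed cell of σ is
-- B_1 + … + B_n with B_k = conv { e_m : (k , m) ∈ σ }.  It is the j-th
-- unmixed simplex iff B_j = Δ_{d-1} and every other B_k is a vertex.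

Unmixed : ∀ {n d} → VSet n d → Fin n → Set
Unmixed {n} {d} σ j =
  (∀ m → σ j m ≡ true) ×
  (∀ k → ¬ (k ≡ j) → ∃ λ m → σ k m ≡ true × (∀ m′ → σ k m′ ≡ true → m′ ≡ m))
  where open import Relation.Nullary using (¬_)

-- position v_j = sum over k ≠ j of the vertex B_k
unmixedPos : ∀ {n d} → VSet n d → Fin n → Fin d → ℕ
unmixedPos σ j m =
  sumℕ (λ k → if does (k ≟ j) then 0 else (if σ k m then 1 else 0))

Realizable : ∀ {n d} → (Fin n → Fin d → ℕ) → Set
Realizable {n} {d} v =
  Σ (List (VSet n d)) λ T → IsTriangulation T ×
    (∀ j → Any (λ σ → Unmixed σ j × (∀ m → unmixedPos σ j m ≡ v j m)) T)

module Submission where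

-- The rank ρ j = v_j(i) is a bijection from the rows onto {0, …, n − 1}. Spread-out: if S has
-- least i-coordinate μ and highest rank M, attained at jmax, the coordinatewise minima over S
-- sum to at most μ + (n − 1 − M) (bound them by v_jmax off column i), while S lies among the
-- M − μ + 1 rows of rank in [μ, M].
--
-- Realizability: every order on the cells of Δ_{n−1} × Δ_{d−1} yields a pulling triangulation
-- (cone from the first cell of the box over the triangulations of the two facets avoiding it);
-- affine independence, covering (northwest-corner rule) and coherence of barycentric
-- coordinates follow by induction on the box. List the cells column by column, column i first
-- with the rows by increasing rank. Pulling reaches row j's unmixed simplex by deleting, in each
-- column, the remaining rows met before j; in column i these are the ρ j rows of smaller rank.
-- The other columns are ordered by inserting the rows from the highest rank down, row x going
-- right after v_x(c) of the higher rows it has not yet passed; rows inserted later have smaller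
-- rank and are gone after column i in x's pass.

open import Defs
open import Data.Bool.Base using (Bool; true; false; if_then_else_; _∧_; _∨_; not)
import Data.Bool.Properties as Boolₚ
open import Data.Empty using (⊥; ⊥-elim)
open import Data.Fin.Base using (Fin; zero; suc; toℕ; punchIn; punchOut)
open import Data.Fin.Properties using (_≟_)
import Data.Fin.Properties as Finₚ
open import Data.Fin.Subset using (Subset; ∣_∣)
import Data.Fin.Subset as FS
open import Data.Fin.Subset.Properties using (_∈?_)
open import Data.List.Base using (List; []; _∷_; _++_; map; foldr; filter; allFin; tabulate; cartesianProduct)
import Data.List.Properties as Listₚ
open import Data.List.Extrema.Nat using (argmax; argmax-all; f[xs]≤f[argmax])
open import Data.List.Membership.Propositional using (_∈_; find; lose)
open import Data.List.Membership.Propositional.Properties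
  using (∈-++⁺ˡ; ∈-++⁺ʳ; ∈-++⁻; ∈-map⁺; ∈-map⁻; ∈-allFin; ∈-cartesianProduct⁺; ∈-filter⁺; ∈-filter⁻;
         ∈-tabulate⁺; ∈-tabulate⁻)
open import Data.List.Relation.Binary.Pointwise.Base using (Pointwise; []; _∷_)
open import Data.List.Relation.Unary.All as All using (All; []; _∷_)
open import Data.List.Relation.Unary.All.Properties using (All¬⇒¬Any)
open import Data.List.Relation.Unary.AllPairs using (_∷_)
open import Data.List.Relation.Unary.Any as Any using (Any; here; there)
open import Data.List.Relation.Unary.Unique.Propositional using (Unique)
import Data.List.Relation.Unary.Unique.Propositional.Properties as Uniqueₚ
open import Data.Nat.Base as ℕ using (ℕ; zero; suc; _+_; _∸_; _≤_; _<_; z≤n; s≤s)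
open import Data.Nat.ListAction using (sum)
open import Data.Nat.Properties using (_≤?_)
import Data.Nat.Properties as ℕₚ
open import Data.Nat.Solver using () renaming (module +-*-Solver to ℕ-Solver)
open import Data.Product.Base using (Σ; ∃; ∃₂; _×_; _,_; proj₁; proj₂; map₁)
open import Data.Rational.Base as ℚ using (ℚ; 0ℚ)
import Data.Rational.Properties as ℚₚ
open import Data.Rational.Solver using () renaming (module +-*-Solver to ℚ-Solver)
open import Data.Sum.Base using (_⊎_; inj₁; inj₂)
open import Data.Vec.Base using ([]; _∷_)
open import Function.Base using (_∘_; case_of_)
open import Relation.Binary.PropositionalEquality
open import Relation.Nullary using (Dec; ¬_; yes; no; does)
open import Relation.Nullary.Decidable using (dec-true; dec-false; toSum)

infix 7 _≡ᵇ_
infix 4 _∈ᵇ_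

_≡ᵇ_ : ∀ {k} → Fin k → Fin k → Bool
x ≡ᵇ y = does (x ≟ y)

≡ᵇ-refl : ∀ {k} (x : Fin k) → (x ≡ᵇ x) ≡ true
≡ᵇ-refl x = dec-true (x ≟ x) refl

≢⇒≡ᵇ-false : ∀ {k} {x y : Fin k} → ¬ x ≡ y → (x ≡ᵇ y) ≡ false
≢⇒≡ᵇ-false {x = x} {y} = dec-false (x ≟ y)

does-true⇒ : ∀ {A : Set} (a? : Dec A) → does a? ≡ true → A
does-true⇒ (yes a) _ = a

does-false⇒ : ∀ {A : Set} (a? : Dec A) → does a? ≡ false → ¬ A
does-false⇒ (no ¬a) _ = ¬a

≡ᵇ⇒≡ : ∀ {k} {x y : Fin k} → (x ≡ᵇ y) ≡ true → x ≡ y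
≡ᵇ⇒≡ {x = x} {y} = does-true⇒ (x ≟ y)

false≢true : false ≡ true → ⊥
false≢true ()

if-true : ∀ {A : Set} {b} (x y : A) → b ≡ true → (if b then x else y) ≡ x
if-true x y refl = refl

if-false : ∀ {A : Set} {b} (x y : A) → b ≡ false → (if b then x else y) ≡ y
if-false x y refl = refl

∧-true : ∀ {x y} → x ≡ true → y ≡ true → x ∧ y ≡ true
∧-true refl refl = refl

∧-trueˡ : ∀ {x y} → x ∧ y ≡ true → x ≡ true
∧-trueˡ {true} _ = refl

∧-trueʳ : ∀ {x y} → x ∧ y ≡ true → y ≡ true
∧-trueʳ {true} e = e

∨-trueʳ : ∀ x {y} → y ≡ true → x ∨ y ≡ true
∨-trueʳ true _ = refl
∨-trueʳ false e = e

∨-resolve : ∀ {a b e} → a ≡ false → b ≡ false → a ∨ b ∨ e ≡ true → e ≡ true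
∨-resolve refl refl e = e

_∈ᵇ_ : ∀ {k} → Fin k → List (Fin k) → Bool
x ∈ᵇ [] = false
x ∈ᵇ (y ∷ ys) = (x ≡ᵇ y) ∨ (x ∈ᵇ ys)

∈⇒∈ᵇ : ∀ {k} {x : Fin k} {xs} → x ∈ xs → (x ∈ᵇ xs) ≡ true
∈⇒∈ᵇ {x = x} (here refl) rewrite ≡ᵇ-refl x = refl
∈⇒∈ᵇ {x = x} {y ∷ _} (there x∈xs) = ∨-trueʳ (x ≡ᵇ y) (∈⇒∈ᵇ x∈xs)

∉⇒∈ᵇ-false : ∀ {k} {x : Fin k} xs → ¬ x ∈ xs → (x ∈ᵇ xs) ≡ false
∉⇒∈ᵇ-false [] _ = refl
∉⇒∈ᵇ-false (y ∷ ys) x∉ rewrite ≢⇒≡ᵇ-false (λ x≡y → x∉ (here x≡y)) = ∉⇒∈ᵇ-false ys (λ x∈ → x∉ (there x∈))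

∈ᵇ-head : ∀ {k} (x : Fin k) xs → (x ∈ᵇ x ∷ xs) ≡ true
∈ᵇ-head x xs = ∈⇒∈ᵇ {xs = x ∷ xs} (here refl)

sumℕ-cong : ∀ {k} {f g : Fin k → ℕ} → (∀ x → f x ≡ g x) → sumℕ f ≡ sumℕ g
sumℕ-cong {zero} e = refl
sumℕ-cong {suc k} e = cong₂ _+_ (e zero) (sumℕ-cong (λ x → e (suc x)))

sumℕ-extract : ∀ {k} (f : Fin k → ℕ) (r : Fin k) →
  sumℕ f ≡ f r + sumℕ (λ x → if x ≡ᵇ r then 0 else f x)
sumℕ-extract {suc k} f zero = refl
sumℕ-extract {suc k} f (suc r) = begin
  f zero + sumℕ (λ x → f (suc x))  ≡⟨ cong (f zero +_) (sumℕ-extract (λ x → f (suc x)) r) ⟩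
  f zero + (f (suc r) + rest)       ≡⟨ ℕₚ.+-comm (f zero) _ ⟩
  (f (suc r) + rest) + f zero       ≡⟨ ℕₚ.+-assoc (f (suc r)) rest (f zero) ⟩
  f (suc r) + (rest + f zero)       ≡⟨ cong (f (suc r) +_) (ℕₚ.+-comm rest (f zero)) ⟩
  f (suc r) + (f zero + rest)       ∎
  where
  open ≡-Reasoning
  rest = sumℕ (λ x → if x ≡ᵇ r then 0 else f (suc x))

sumℕ-zero : ∀ {k} (f : Fin k → ℕ) → (∀ x → f x ≡ 0) → sumℕ f ≡ 0
sumℕ-zero {zero} f _ = refl
sumℕ-zero {suc k} f f≡0 rewrite f≡0 zero = sumℕ-zero (λ x → f (suc x)) (λ x → f≡0 (suc x))

sumℕ≡0⇒zero : ∀ {k} (f : Fin k → ℕ) → sumℕ f ≡ 0 → ∀ x → f x ≡ 0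
sumℕ≡0⇒zero {suc k} f e zero = ℕₚ.m+n≡0⇒m≡0 (f zero) e
sumℕ≡0⇒zero {suc k} f e (suc x) = sumℕ≡0⇒zero (λ y → f (suc y)) (ℕₚ.m+n≡0⇒n≡0 (f zero) e) x

sumℕ-mono : ∀ {k} {f g : Fin k → ℕ} → (∀ x → f x ≤ g x) → sumℕ f ≤ sumℕ g
sumℕ-mono {zero} _ = z≤n
sumℕ-mono {suc k} f≤g = ℕₚ.+-mono-≤ (f≤g zero) (sumℕ-mono (λ x → f≤g (suc x)))

sumℕ-+ : ∀ {k} (f g : Fin k → ℕ) → sumℕ (λ x → f x + g x) ≡ sumℕ f + sumℕ g
sumℕ-+ {zero} f g = refl
sumℕ-+ {suc k} f g rewrite sumℕ-+ (λ x → f (suc x)) (λ x → g (suc x)) =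
  solve 4 (λ a b c e → (a :+ b) :+ (c :+ e) := (a :+ c) :+ (b :+ e)) refl
    (f zero) (g zero) (sumℕ (λ x → f (suc x))) (sumℕ (λ x → g (suc x)))
  where open ℕ-Solver

sumℕ-punchIn : ∀ {k} (f : Fin (suc k) → ℕ) r → sumℕ f ≡ f r + sumℕ (λ x → f (punchIn r x))
sumℕ-punchIn f zero = refl
sumℕ-punchIn {suc k} f (suc r) = begin
  f zero + sumℕ (λ x → f (suc x))                       ≡⟨ cong (f zero +_) (sumℕ-punchIn (λ x → f (suc x)) r) ⟩
  f zero + (f (suc r) + rest)                            ≡⟨ ℕₚ.+-assoc (f zero) _ _ ⟨
  (f zero + f (suc r)) + rest                            ≡⟨ cong (_+ rest) (ℕₚ.+-comm (f zero) _) ⟩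
  (f (suc r) + f zero) + rest                            ≡⟨ ℕₚ.+-assoc (f (suc r)) _ _ ⟩
  f (suc r) + (f zero + rest)                            ∎
  where
  open ≡-Reasoning
  rest = sumℕ (λ x → f (suc (punchIn r x)))

sum-tabulate : ∀ {k} (f : Fin k → ℕ) → sum (tabulate f) ≡ sumℕ f
sum-tabulate {zero} f = refl
sum-tabulate {suc k} f = cong (f zero +_) (sum-tabulate (λ x → f (suc x)))

_[_]≔_ : ∀ {k} {A : Set} → (Fin k → A) → Fin k → A → Fin k → A
(f [ r ]≔ v) x = if x ≡ᵇ r then v else f x

[]≔-here : ∀ {k} {A : Set} (f : Fin k → A) r v → (f [ r ]≔ v) r ≡ v
[]≔-here f r v rewrite ≡ᵇ-refl r = refl

[]≔-other : ∀ {k} {A : Set} (f : Fin k → A) v {r x} → ¬ x ≡ r → (f [ r ]≔ v) x ≡ f x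
[]≔-other f v x≢r rewrite ≢⇒≡ᵇ-false x≢r = refl

sumℚ-cong : ∀ {k} {f g : Fin k → ℚ} → (∀ x → f x ≡ g x) → sumℚ f ≡ sumℚ g
sumℚ-cong {zero} e = refl
sumℚ-cong {suc k} e = cong₂ ℚ._+_ (e zero) (sumℚ-cong (λ x → e (suc x)))

sumℚ-update : ∀ {k} (f : Fin k → ℚ) r v → sumℚ (f [ r ]≔ v) ≡ sumℚ f ℚ.+ (v ℚ.- f r)
sumℚ-update {suc k} f zero v =
  solve 3 (λ v a s → v :+ s := (a :+ s) :+ (v :- a)) refl v (f zero) (sumℚ (λ x → f (suc x)))
  where open ℚ-Solver
sumℚ-update {suc k} f (suc r) v =
  trans (cong (f zero ℚ.+_) (sumℚ-update (λ x → f (suc x)) r v))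
        (sym (ℚₚ.+-assoc (f zero) _ _))

sumℚ-zero : ∀ {k} (f : Fin k → ℚ) → (∀ x → f x ≡ 0ℚ) → sumℚ f ≡ 0ℚ
sumℚ-zero {zero} f _ = refl
sumℚ-zero {suc k} f f≡0 rewrite f≡0 zero =
  trans (ℚₚ.+-identityˡ _) (sumℚ-zero (λ x → f (suc x)) (λ x → f≡0 (suc x)))

sumℚ-nonneg : ∀ {k} (f : Fin k → ℚ) → (∀ x → 0ℚ ℚ.≤ f x) → 0ℚ ℚ.≤ sumℚ f
sumℚ-nonneg {zero} f _ = ℚₚ.≤-refl
sumℚ-nonneg {suc k} f f≥0 =
  ℚₚ.+-mono-≤ (f≥0 zero) (sumℚ-nonneg (λ x → f (suc x)) (λ x → f≥0 (suc x)))

term≤sumℚ : ∀ {k} (f : Fin k → ℚ) → (∀ x → 0ℚ ℚ.≤ f x) → ∀ r → f r ℚ.≤ sumℚ f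
term≤sumℚ {suc k} f f≥0 zero =
  subst (ℚ._≤ sumℚ f) (ℚₚ.+-identityʳ (f zero))
    (ℚₚ.+-monoʳ-≤ (f zero) (sumℚ-nonneg (λ x → f (suc x)) (λ x → f≥0 (suc x))))
term≤sumℚ {suc k} f f≥0 (suc r) =
  subst (ℚ._≤ sumℚ f) (ℚₚ.+-identityˡ (f (suc r)))
    (ℚₚ.+-mono-≤ (f≥0 zero) (term≤sumℚ (λ x → f (suc x)) (λ x → f≥0 (suc x)) r))

sumℚ≡0⇒zero : ∀ {k} (f : Fin k → ℚ) → (∀ x → 0ℚ ℚ.≤ f x) → sumℚ f ≡ 0ℚ → ∀ x → f x ≡ 0ℚ
sumℚ≡0⇒zero f f≥0 Σ≡0 x = ℚₚ.≤-antisym (subst (f x ℚ.≤_) Σ≡0 (term≤sumℚ f f≥0 x)) (f≥0 x)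

sumℚ-single : ∀ {k} (f : Fin k → ℚ) r → (∀ x → ¬ x ≡ r → f x ≡ 0ℚ) → sumℚ f ≡ f r
sumℚ-single {suc k} f zero off =
  trans (cong (f zero ℚ.+_) (sumℚ-zero _ (λ x → off (suc x) λ ()))) (ℚₚ.+-identityʳ (f zero))
sumℚ-single {suc k} f (suc r) off =
  trans (cong (ℚ._+ sumℚ (λ x → f (suc x))) (off zero λ ()))
    (trans (ℚₚ.+-identityˡ (sumℚ (λ x → f (suc x))))
      (sumℚ-single (λ x → f (suc x)) r (λ x x≢r → off (suc x) (x≢r ∘ Finₚ.suc-injective))))

Sub : ℕ → Set
Sub k = Fin k → Bool

full : ∀ {k} → Sub k
full _ = true

infix 4 _⊆ₛ_
_⊆ₛ_ : ∀ {k} → Sub k → Sub k → Set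
R ⊆ₛ R′ = ∀ x → R x ≡ true → R′ x ≡ true

⊆ₛ-refl : ∀ {k} {R : Sub k} → R ⊆ₛ R
⊆ₛ-refl _ e = e

_─_ : ∀ {k} → Sub k → Fin k → Sub k
(R ─ r) = R [ r ]≔ false

─-self : ∀ {k} (R : Sub k) r → (R ─ r) r ≡ false
─-self R r = []≔-here R r false

─-other : ∀ {k} (R : Sub k) {r x} → ¬ x ≡ r → (R ─ r) x ≡ R x
─-other R = []≔-other R false

─-⊆ : ∀ {k} (R : Sub k) r → (R ─ r) ⊆ₛ R
─-⊆ R r x e with x ≡ᵇ r
... | false = e

─-comm : ∀ {k} (R : Sub k) r s x → ((R ─ r) ─ s) x ≡ ((R ─ s) ─ r) x
─-comm R r s x with x ≡ᵇ r | x ≡ᵇ s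
... | true  | true  = refl
... | true  | false = refl
... | false | true  = refl
... | false | false = refl

𝟙 : Bool → ℕ
𝟙 b = if b then 1 else 0

count : ∀ {k} → Sub k → ℕ
count R = sumℕ (λ x → 𝟙 (R x))

count-cong : ∀ {k} {R R′ : Sub k} → (∀ x → R x ≡ R′ x) → count R ≡ count R′
count-cong e = sumℕ-cong (λ x → cong 𝟙 (e x))

count-─ : ∀ {k} (R : Sub k) r → R r ≡ true → count R ≡ suc (count (R ─ r))
count-─ R r Rr = trans (sumℕ-extract _ r) (cong₂ _+_ (cong 𝟙 Rr) (sumℕ-cong after))
  where
  after : ∀ x → (if x ≡ᵇ r then 0 else 𝟙 (R x)) ≡ 𝟙 ((R ─ r) x)
  after x with x ≡ᵇ r
  ... | true  = refl
  ... | false = refl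

count≡0⇒empty : ∀ {k} (R : Sub k) → count R ≡ 0 → ∀ x → R x ≡ false
count≡0⇒empty R e x with R x | sumℕ≡0⇒zero _ e x
... | false | _ = refl

count≡suc⇒inhabited : ∀ {k} (R : Sub k) {m} → count R ≡ suc m → ∃ λ x → R x ≡ true
count≡suc⇒inhabited {suc k} R e with R zero in R0
... | true  = zero , R0
... | false = let x , Rx = count≡suc⇒inhabited (λ y → R (suc y)) e in suc x , Rx

count≡1⇒unique : ∀ {k} (R : Sub k) {h x} → count R ≡ 1 → R h ≡ true → R x ≡ true → x ≡ h
count≡1⇒unique R {h} {x} e Rh Rx with x ≟ h
... | yes x≡h = x≡h
... | no x≢h = ⊥-elim (false≢true (trans (sym (count≡0⇒empty (R ─ h) count≡0 x)) (trans (─-other R x≢h) Rx)))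
  where count≡0 = ℕₚ.suc-injective (trans (sym (count-─ R h Rh)) e)

count≡1⇒only : ∀ {k} (R : Sub k) {h x} → count R ≡ 1 → R h ≡ true → ¬ x ≡ h → R x ≡ false
count≡1⇒only R {x = x} e Rh x≢h with R x in Rx
... | false = refl
... | true  = ⊥-elim (x≢h (count≡1⇒unique R e Rh Rx))

count≥2⇒other : ∀ {k} (R : Sub k) {m h} → count R ≡ suc (suc m) → R h ≡ true →
                ∃ λ x → R x ≡ true × ¬ x ≡ h
count≥2⇒other R {h = h} e Rh
  with x , Rx ← count≡suc⇒inhabited (R ─ h) (ℕₚ.suc-injective (trans (sym (count-─ R h Rh)) e))
  with x ≟ h
... | yes refl = ⊥-elim (false≢true Rx)
... | no x≢h = x , Rx , x≢h

count-mono : ∀ {k} {R R′ : Sub k} → R ⊆ₛ R′ → count R ≤ count R′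
count-mono {R = R} {R′} R⊆R′ = sumℕ-mono pointwise
  where
  pointwise : ∀ x → 𝟙 (R x) ≤ 𝟙 (R′ x)
  pointwise x with R x in Rx
  ... | false = z≤n
  ... | true rewrite R⊆R′ x Rx = ℕₚ.≤-refl

count-full : ∀ k → count (full {k}) ≡ k
count-full zero = refl
count-full (suc k) = cong suc (count-full k)

count-partition : ∀ {k} (S U : Sub k) → count S ≡ count (λ x → S x ∧ U x) + count (λ x → S x ∧ not (U x))
count-partition S U = trans (sumℕ-cong split) (sumℕ-+ (λ x → 𝟙 (S x ∧ U x)) (λ x → 𝟙 (S x ∧ not (U x))))
  where
  split : ∀ x → 𝟙 (S x) ≡ 𝟙 (S x ∧ U x) + 𝟙 (S x ∧ not (U x))
  split x with S x | U x
  ... | true  | true  = refl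
  ... | true  | false = refl
  ... | false | _     = refl

-- Pulling triangulations

module _ {n d : ℕ} where

  emptyV : VSet n d
  emptyV _ _ = false

  addCell : Fin n × Fin d → VSet n d → VSet n d
  addCell (h , c) σ r m = (r ≡ᵇ h ∧ m ≡ᵇ c) ∨ σ r m

  infix 4 _⊆ᵥ_
  _⊆ᵥ_ : VSet n d → VSet n d → Set
  σ ⊆ᵥ τ = ∀ x m → σ x m ≡ true → τ x m ≡ true

  addCell⁻ : ∀ h c σ x m → addCell (h , c) σ x m ≡ true → (x ≡ h × m ≡ c) ⊎ σ x m ≡ true
  addCell⁻ h c σ x m e with x ≡ᵇ h in x≡h | m ≡ᵇ c in m≡c | σ x m in σxm
  ... | true  | true  | _     = inj₁ (≡ᵇ⇒≡ x≡h , ≡ᵇ⇒≡ m≡c)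
  ... | _     | _     | true  = inj₂ refl
  ... | true  | false | false = ⊥-elim (false≢true e)
  ... | false | _     | false = ⊥-elim (false≢true e)

  addCell-new : ∀ h c σ → addCell (h , c) σ h c ≡ true
  addCell-new h c σ rewrite ≡ᵇ-refl h | ≡ᵇ-refl c = refl

  addCell-new′ : ∀ h c σ {x m} → x ≡ h → m ≡ c → addCell (h , c) σ x m ≡ true
  addCell-new′ h c σ refl refl = addCell-new h c σ

  addCell-old : ∀ h c σ x m → σ x m ≡ true → addCell (h , c) σ x m ≡ true
  addCell-old h c σ x m σxm = ∨-trueʳ ((x ≡ᵇ h) ∧ (m ≡ᵇ c)) σxm

  addCell-offRow : ∀ h c σ {x m} → addCell (h , c) σ x m ≡ true → ¬ x ≡ h → σ x m ≡ true
  addCell-offRow h c σ {x} {m} e x≢h with addCell⁻ h c σ x m e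
  ... | inj₁ (x≡h , _) = ⊥-elim (x≢h x≡h)
  ... | inj₂ σxm = σxm

  addCell-offCol : ∀ h c σ {x m} → addCell (h , c) σ x m ≡ true → ¬ m ≡ c → σ x m ≡ true
  addCell-offCol h c σ {x} {m} e m≢c with addCell⁻ h c σ x m e
  ... | inj₁ (_ , m≡c) = ⊥-elim (m≢c m≡c)
  ... | inj₂ σxm = σxm

  addCell-mono : ∀ h c {σ τ} → σ ⊆ᵥ τ → addCell (h , c) σ ⊆ᵥ addCell (h , c) τ
  addCell-mono h c {σ} {τ} σ⊆τ x m e with addCell⁻ h c σ x m e
  ... | inj₁ (refl , refl) = addCell-new h c τ
  ... | inj₂ σxm = addCell-old h c τ x m (σ⊆τ x m σxm)

  emptyV-⊆ : ∀ τ → emptyV ⊆ᵥ τ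
  emptyV-⊆ τ x m ()

  _⊆ᵥ_offRow_ : VSet n d → VSet n d → Fin n → Set
  σ ⊆ᵥ σ′ offRow r = ∀ x m → ¬ x ≡ r → σ x m ≡ true → σ′ x m ≡ true

  _⊆ᵥ_offCol_ : VSet n d → VSet n d → Fin d → Set
  σ ⊆ᵥ σ′ offCol c = ∀ x m → ¬ m ≡ c → σ x m ≡ true → σ′ x m ≡ true

  addCell-mono-offRow : ∀ h c {σ σ′ r} → σ ⊆ᵥ σ′ offRow r → addCell (h , c) σ ⊆ᵥ addCell (h , c) σ′ offRow r
  addCell-mono-offRow h c {σ} {σ′} σ⊆ x m x≢r e with addCell⁻ h c σ x m e
  ... | inj₁ (refl , refl) = addCell-new h c σ′
  ... | inj₂ σxm = addCell-old h c σ′ x m (σ⊆ x m x≢r σxm)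

  addCell-mono-offCol : ∀ h c {σ σ′ c₀} → σ ⊆ᵥ σ′ offCol c₀ → addCell (h , c) σ ⊆ᵥ addCell (h , c) σ′ offCol c₀
  addCell-mono-offCol h c {σ} {σ′} σ⊆ x m m≢c e with addCell⁻ h c σ x m e
  ... | inj₁ (refl , refl) = addCell-new h c σ′
  ... | inj₂ σxm = addCell-old h c σ′ x m (σ⊆ x m m≢c σxm)

module _ {n d : ℕ} where

  setCell : Weights n d → Fin n → Fin d → ℚ → Weights n d
  setCell w h c v r m = if r ≡ᵇ h ∧ m ≡ᵇ c then v else w r m

  setCell-offRow : ∀ w h c v {r} m → ¬ r ≡ h → (setCell w h c v) r m ≡ w r m
  setCell-offRow w h c v m r≢h rewrite ≢⇒≡ᵇ-false r≢h = refl

  setCell-offCol : ∀ w h c v r {m} → ¬ m ≡ c → (setCell w h c v) r m ≡ w r m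
  setCell-offCol w h c v r {m} m≢c rewrite ≢⇒≡ᵇ-false m≢c | Boolₚ.∧-zeroʳ (r ≡ᵇ h) = refl

  rowSum-setCell : ∀ w h c v r →
    rowSum (setCell w h c v) r ≡ rowSum w r ℚ.+ (if r ≡ᵇ h then v ℚ.- w h c else 0ℚ)
  rowSum-setCell w h c v r with toSum (r ≟ h)
  ... | inj₁ refl rewrite ≡ᵇ-refl r = sumℚ-update (w r) c v
  ... | inj₂ r≢h rewrite ≢⇒≡ᵇ-false r≢h = sym (ℚₚ.+-identityʳ (rowSum w r))

  colSum-setCell : ∀ w h c v m →
    colSum (setCell w h c v) m ≡ colSum w m ℚ.+ (if m ≡ᵇ c then v ℚ.- w h c else 0ℚ)
  colSum-setCell w h c v m with toSum (m ≟ c)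
  ... | inj₁ refl rewrite ≡ᵇ-refl m =
    trans (sumℚ-cong (λ r → cong (if_then v else w r m) (Boolₚ.∧-identityʳ (r ≡ᵇ h))))
          (sumℚ-update (λ r → w r m) h v)
  ... | inj₂ m≢c =
    trans (sumℚ-cong (λ r → setCell-offCol w h c v r m≢c))
          (trans (sym (ℚₚ.+-identityʳ (colSum w m))) (cong (colSum w m ℚ.+_) (sym (if-false _ _ (≢⇒≡ᵇ-false m≢c)))))

  setCell-nonneg : ∀ w h c v → NonNeg w → 0ℚ ℚ.≤ v → NonNeg (setCell w h c v)
  setCell-nonneg w h c v w≥0 v≥0 r m with r ≡ᵇ h ∧ m ≡ᵇ c
  ... | true  = v≥0
  ... | false = w≥0 r m

  zeroCell-supported : ∀ w h c σ → SupportedOn (addCell (h , c) σ) w → SupportedOn σ (setCell w h c 0ℚ)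
  zeroCell-supported w h c σ supp r m σrm with r ≡ᵇ h ∧ m ≡ᵇ c in at-hc
  ... | true  = refl
  ... | false = supp r m (trans (cong (_∨ σ r m) at-hc) σrm)

  setCell-supported : ∀ w h c v σ → SupportedOn σ w → SupportedOn (addCell (h , c) σ) (setCell w h c v)
  setCell-supported w h c v σ supp r m e with r ≡ᵇ h ∧ m ≡ᵇ c
  ... | false = supp r m e

  ≗-fromZeroCell : ∀ w w′ h c → w h c ≡ w′ h c →
                   (∀ r m → (setCell w h c 0ℚ) r m ≡ (setCell w′ h c 0ℚ) r m) → ∀ r m → w r m ≡ w′ r m
  ≗-fromZeroCell w w′ h c at-hc off r m with toSum (r ≟ h) | toSum (m ≟ c)
  ... | inj₁ refl | inj₁ refl = at-hc
  ... | inj₁ refl | inj₂ m≢c =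
    trans (sym (setCell-offCol w r c 0ℚ r m≢c)) (trans (off r m) (setCell-offCol w′ r c 0ℚ r m≢c))
  ... | inj₂ r≢h | _ =
    trans (sym (setCell-offRow w h c 0ℚ m r≢h)) (trans (off r m) (setCell-offRow w′ h c 0ℚ m r≢h))

  Marginals≡ : Weights n d → Weights n d → Set
  Marginals≡ w w′ = (∀ r → rowSum w r ≡ rowSum w′ r) × (∀ m → colSum w m ≡ colSum w′ m)

  zeroCell-Marginals≡ : ∀ w w′ h c → w h c ≡ w′ h c → Marginals≡ w w′ →
                        Marginals≡ (setCell w h c 0ℚ) (setCell w′ h c 0ℚ)
  zeroCell-Marginals≡ w w′ h c at-hc (rows , cols) =
    (λ r → trans (rowSum-setCell w h c 0ℚ r)
             (trans (cong₂ (λ s t → s ℚ.+ (if r ≡ᵇ h then 0ℚ ℚ.- t else 0ℚ)) (rows r) at-hc)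
                    (sym (rowSum-setCell w′ h c 0ℚ r)))) ,
    (λ m → trans (colSum-setCell w h c 0ℚ m)
             (trans (cong₂ (λ s t → s ℚ.+ (if m ≡ᵇ c then 0ℚ ℚ.- t else 0ℚ)) (cols m) at-hc)
                    (sym (colSum-setCell w′ h c 0ℚ m))))

  zeroCell-emptyRow : ∀ w h c → rowSum w h ≡ w h c → rowSum (setCell w h c 0ℚ) h ≡ 0ℚ
  zeroCell-emptyRow w h c row≡ rewrite rowSum-setCell w h c 0ℚ h | ≡ᵇ-refl h | row≡ =
    solve 1 (λ x → x :+ (con 0ℚ :- x) := con 0ℚ) refl (w h c)
    where open ℚ-Solver

  zeroCell-emptyCol : ∀ w h c → colSum w c ≡ w h c → colSum (setCell w h c 0ℚ) c ≡ 0ℚ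
  zeroCell-emptyCol w h c col≡ rewrite colSum-setCell w h c 0ℚ c | ≡ᵇ-refl c | col≡ =
    solve 1 (λ x → x :+ (con 0ℚ :- x) := con 0ℚ) refl (w h c)
    where open ℚ-Solver

  rowSum-apex : ∀ w h c (σ : VSet n d) → SupportedOn (addCell (h , c) σ) w → (∀ m → σ h m ≡ false) → rowSum w h ≡ w h c
  rowSum-apex w h c σ supp free = sumℚ-single (w h) c (λ m m≢c → supp h m (offApex m m≢c))
    where
    offApex : ∀ m → ¬ m ≡ c → addCell (h , c) σ h m ≡ false
    offApex m m≢c rewrite ≡ᵇ-refl h | ≢⇒≡ᵇ-false m≢c = free m

  colSum-apex : ∀ w h c (σ : VSet n d) → SupportedOn (addCell (h , c) σ) w → (∀ r → σ r c ≡ false) → colSum w c ≡ w h c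
  colSum-apex w h c σ supp free = sumℚ-single (λ r → w r c) h (λ r r≢h → supp r c (offApex r r≢h))
    where
    offApex : ∀ r → ¬ r ≡ h → addCell (h , c) σ r c ≡ false
    offApex r r≢h rewrite ≡ᵇ-refl c | ≢⇒≡ᵇ-false r≢h = free r

  offRow-supported : ∀ w h {σ σ′ : VSet n d} → SupportedOn σ w → σ ⊆ᵥ σ′ offRow h → (∀ m → w h m ≡ 0ℚ) →
                     SupportedOn σ′ w
  offRow-supported w h {σ} supp σ⊆ emptyRow r m σ′rm with toSum (r ≟ h)
  ... | inj₁ refl = emptyRow m
  ... | inj₂ r≢h with σ r m in σrm
  ...   | false = supp r m σrm
  ...   | true  = ⊥-elim (false≢true (trans (sym σ′rm) (σ⊆ r m r≢h σrm)))

  offCol-supported : ∀ w c {σ σ′ : VSet n d} → SupportedOn σ w → σ ⊆ᵥ σ′ offCol c → (∀ r → w r c ≡ 0ℚ) →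
                     SupportedOn σ′ w
  offCol-supported w c {σ} supp σ⊆ emptyCol r m σ′rm with toSum (m ≟ c)
  ... | inj₁ refl = emptyCol r
  ... | inj₂ m≢c with σ r m in σrm
  ...   | false = supp r m σrm
  ...   | true  = ⊥-elim (false≢true (trans (sym σ′rm) (σ⊆ r m m≢c σrm)))

module Pulling {n d : ℕ} (L : List (Fin n × Fin d)) (fallback : Fin n × Fin d) where

  Cell : Set
  Cell = Fin n × Fin d

  firstSat : (Cell → Bool) → List Cell → Cell
  firstSat P [] = fallback
  firstSat P (x ∷ xs) = if P x then x else firstSat P xs

  firstSat-sat : ∀ (P : Cell → Bool) xs → Any (λ y → P y ≡ true) xs → P (firstSat P xs) ≡ true
  firstSat-sat P (x ∷ xs) sat with P x in Px
  ... | true = Px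
  firstSat-sat P (x ∷ xs) (here Px′)  | false = ⊥-elim (false≢true (trans (sym Px) Px′))
  firstSat-sat P (x ∷ xs) (there sat) | false = firstSat-sat P xs sat

  firstSat-restrict : ∀ (P P′ : Cell → Bool) xs → (∀ y → P′ y ≡ true → P y ≡ true) →
                      P′ (firstSat P xs) ≡ true → firstSat P′ xs ≡ firstSat P xs
  firstSat-restrict P P′ [] _ _ = refl
  firstSat-restrict P P′ (x ∷ xs) P′⊆P sat with P x in Px | P′ x in P′x
  ... | true  | true  = refl
  ... | true  | false = ⊥-elim (false≢true (trans (sym P′x) sat))
  ... | false | true  = ⊥-elim (false≢true (trans (sym Px) (P′⊆P x P′x)))
  ... | false | false = firstSat-restrict P P′ xs P′⊆P sat

  firstSat-cong : ∀ (P P′ : Cell → Bool) xs → (∀ y → P y ≡ P′ y) → firstSat P xs ≡ firstSat P′ xs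
  firstSat-cong P P′ [] _ = refl
  firstSat-cong P P′ (x ∷ xs) P≗P′ rewrite P≗P′ x with P′ x
  ... | true  = refl
  ... | false = firstSat-cong P P′ xs P≗P′

  allCells : List Cell
  allCells = cartesianProduct (allFin n) (allFin d)

  inBox : Sub n → Sub d → Cell → Bool
  inBox R C (r , c) = R r ∧ C c

  -- Appending all cells puts the pivot of a non-empty box inside it, whatever L is.
  pivot : Sub n → Sub d → Cell
  pivot R C = firstSat (inBox R C) (L ++ allCells)

  -- triang a b R C triangulates Δ_R × Δ_C for |R| = a + 1, |C| = b + 1:
  -- cone from the pivot over the triangulations of the facets not containing it.
  mutual
    triang : ℕ → ℕ → Sub n → Sub d → List (VSet n d)
    triang zero    zero    R C = addCell (pivot R C) emptyV ∷ []
    triang zero    (suc b) R C = pullCol zero b R C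
    triang (suc a) zero    R C = pullRow a zero R C
    triang (suc a) (suc b) R C = pullRow a (suc b) R C ++ pullCol (suc a) b R C

    pullRow : ℕ → ℕ → Sub n → Sub d → List (VSet n d)
    pullRow a b R C = map (addCell (pivot R C)) (triang a b (R ─ proj₁ (pivot R C)) C)

    pullCol : ℕ → ℕ → Sub n → Sub d → List (VSet n d)
    pullCol a b R C = map (addCell (pivot R C)) (triang a b R (C ─ proj₂ (pivot R C)))

  data Step (a b : ℕ) (R : Sub n) (C : Sub d) (h : Fin n) (c : Fin d) : VSet n d → Set where
    base : a ≡ 0 → b ≡ 0 → Step a b R C h c (addCell (h , c) emptyV)
    row  : ∀ {a′ σ} → a ≡ suc a′ → σ ∈ triang a′ b (R ─ h) C → Step a b R C h c (addCell (h , c) σ)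
    col  : ∀ {b′ σ} → b ≡ suc b′ → σ ∈ triang a b′ R (C ─ c) → Step a b R C h c (addCell (h , c) σ)

  step : ∀ a b R C {h c σ} → pivot R C ≡ (h , c) → σ ∈ triang a b R C → Step a b R C h c σ
  step a b R C refl σ∈ = go a b σ∈
    where
    h₀ = proj₁ (pivot R C)
    c₀ = proj₂ (pivot R C)
    go-row : ∀ a b {σ} → σ ∈ pullRow a b R C → Step (suc a) b R C h₀ c₀ σ
    go-row a b σ∈ with _ , σ′∈ , refl ← ∈-map⁻ (addCell (pivot R C)) σ∈ = row refl σ′∈
    go-col : ∀ a b {σ} → σ ∈ pullCol a b R C → Step a (suc b) R C h₀ c₀ σ
    go-col a b σ∈ with _ , σ′∈ , refl ← ∈-map⁻ (addCell (pivot R C)) σ∈ = col refl σ′∈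
    go : ∀ a b {σ} → σ ∈ triang a b R C → Step a b R C h₀ c₀ σ
    go zero    zero    (here refl) = base refl refl
    go zero    (suc b) σ∈ = go-col zero b σ∈
    go (suc a) zero    σ∈ = go-row a zero σ∈
    go (suc a) (suc b) σ∈ with ∈-++⁻ (pullRow a (suc b) R C) σ∈
    ... | inj₁ σ∈′ = go-row a (suc b) σ∈′
    ... | inj₂ σ∈′ = go-col (suc a) b σ∈′

  ∈-base : ∀ R C {h c} → pivot R C ≡ (h , c) → addCell (h , c) emptyV ∈ triang zero zero R C
  ∈-base R C refl = here refl

  ∈-row : ∀ a b R C {h c σ} → pivot R C ≡ (h , c) → σ ∈ triang a b (R ─ h) C →
          addCell (h , c) σ ∈ triang (suc a) b R C
  ∈-row a zero    R C refl σ∈ = ∈-map⁺ (addCell (pivot R C)) σ∈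
  ∈-row a (suc b) R C refl σ∈ = ∈-++⁺ˡ (∈-map⁺ (addCell (pivot R C)) σ∈)

  ∈-col : ∀ a b R C {h c σ} → pivot R C ≡ (h , c) → σ ∈ triang a b R (C ─ c) →
          addCell (h , c) σ ∈ triang a (suc b) R C
  ∈-col zero    b R C refl σ∈ = ∈-map⁺ (addCell (pivot R C)) σ∈
  ∈-col (suc a) b R C refl σ∈ = ∈-++⁺ʳ (pullRow a (suc b) R C) (∈-map⁺ (addCell (pivot R C)) σ∈)

  pivot-cong : ∀ {R R′ C C′} → (∀ x → R x ≡ R′ x) → (∀ x → C x ≡ C′ x) → pivot R C ≡ pivot R′ C′
  pivot-cong {R} {R′} {C} {C′} R≗R′ C≗C′ =
    firstSat-cong (inBox R C) (inBox R′ C′) (L ++ allCells) (λ (r , c) → cong₂ _∧_ (R≗R′ r) (C≗C′ c))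

  mutual
    triang-cong : ∀ a b {R R′ C C′} → (∀ x → R x ≡ R′ x) → (∀ x → C x ≡ C′ x) →
                  triang a b R C ≡ triang a b R′ C′
    triang-cong zero    zero    R≗R′ C≗C′ = cong (λ p → addCell p emptyV ∷ []) (pivot-cong R≗R′ C≗C′)
    triang-cong zero    (suc b) R≗R′ C≗C′ = pullCol-cong zero b R≗R′ C≗C′
    triang-cong (suc a) zero    R≗R′ C≗C′ = pullRow-cong a zero R≗R′ C≗C′
    triang-cong (suc a) (suc b) R≗R′ C≗C′ =
      cong₂ _++_ (pullRow-cong a (suc b) R≗R′ C≗C′) (pullCol-cong (suc a) b R≗R′ C≗C′)

    pullRow-cong : ∀ a b {R R′ C C′} → (∀ x → R x ≡ R′ x) → (∀ x → C x ≡ C′ x) →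
                   pullRow a b R C ≡ pullRow a b R′ C′
    pullRow-cong a b {R} {R′} {C} {C′} R≗R′ C≗C′ rewrite pivot-cong R≗R′ C≗C′ =
      cong (map (addCell (pivot R′ C′)))
        (triang-cong a b (λ x → cong (if x ≡ᵇ proj₁ (pivot R′ C′) then false else_) (R≗R′ x)) C≗C′)

    pullCol-cong : ∀ a b {R R′ C C′} → (∀ x → R x ≡ R′ x) → (∀ x → C x ≡ C′ x) →
                   pullCol a b R C ≡ pullCol a b R′ C′
    pullCol-cong a b {R} {R′} {C} {C′} R≗R′ C≗C′ rewrite pivot-cong R≗R′ C≗C′ =
      cong (map (addCell (pivot R′ C′)))
        (triang-cong a b R≗R′ (λ x → cong (if x ≡ᵇ proj₂ (pivot R′ C′) then false else_) (C≗C′ x)))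

  ∈triang-cong : ∀ a b {R R′ C C′ σ} → (∀ x → R x ≡ R′ x) → (∀ x → C x ≡ C′ x) →
                 σ ∈ triang a b R C → σ ∈ triang a b R′ C′
  ∈triang-cong a b R≗R′ C≗C′ = subst (_ ∈_) (triang-cong a b R≗R′ C≗C′)

  triang-nonempty : ∀ a b R C → ∃ λ σ → σ ∈ triang a b R C
  triang-nonempty zero zero R C = _ , here refl
  triang-nonempty zero (suc b) R C =
    let _ , σ∈ = triang-nonempty zero b R (C ─ proj₂ (pivot R C)) in _ , ∈-col zero b R C refl σ∈
  triang-nonempty (suc a) b R C =
    let _ , σ∈ = triang-nonempty a b (R ─ proj₁ (pivot R C)) C in _ , ∈-row a b R C refl σ∈

  Sized : ℕ → ℕ → Sub n → Sub d → Set
  Sized a b R C = count R ≡ suc a × count C ≡ suc b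

  Sized-─row : ∀ {a b R C h} → Sized (suc a) b R C → R h ≡ true → Sized a b (R ─ h) C
  Sized-─row {R = R} {h = h} (#R , #C) Rh = ℕₚ.suc-injective (trans (sym (count-─ R h Rh)) #R) , #C

  Sized-─col : ∀ {a b R C c} → Sized a (suc b) R C → C c ≡ true → Sized a b R (C ─ c)
  Sized-─col {C = C} {c = c} (#R , #C) Cc = #R , ℕₚ.suc-injective (trans (sym (count-─ C c Cc)) #C)

  Sized-─row⁻ : ∀ {a b R C r} → Sized a b (R ─ r) C → R r ≡ true → Sized (suc a) b R C
  Sized-─row⁻ {R = R} {r = r} (#R , #C) Rr = trans (count-─ R r Rr) (cong suc #R) , #C

  Sized-─col⁻ : ∀ {a b R C c} → Sized a b R (C ─ c) → C c ≡ true → Sized a (suc b) R C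
  Sized-─col⁻ {C = C} {c = c} (#R , #C) Cc = #R , trans (count-─ C c Cc) (cong suc #C)

  Sized-cong : ∀ {a b R R′ C C′} → (∀ x → R x ≡ R′ x) → (∀ x → C x ≡ C′ x) → Sized a b R C → Sized a b R′ C′
  Sized-cong R≗R′ C≗C′ (#R , #C) = trans (sym (count-cong R≗R′)) #R , trans (sym (count-cong C≗C′)) #C

  pivot∈box : ∀ {a b R C h c} → Sized a b R C → pivot R C ≡ (h , c) → R h ≡ true × C c ≡ true
  pivot∈box {R = R} {C} (#R , #C) refl =
    split (firstSat-sat (inBox R C) (L ++ allCells)
      (lose (∈-++⁺ʳ L (∈-cartesianProduct⁺ (∈-allFin r) (∈-allFin c))) inside))
    where
    r = proj₁ (count≡suc⇒inhabited R #R)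
    c = proj₁ (count≡suc⇒inhabited C #C)
    inside : inBox R C (r , c) ≡ true
    inside = ∧-true (proj₂ (count≡suc⇒inhabited R #R)) (proj₂ (count≡suc⇒inhabited C #C))
    split : ∀ {x y} → x ∧ y ≡ true → x ≡ true × y ≡ true
    split x∧y = ∧-trueˡ x∧y , ∧-trueʳ x∧y

  pivot-restrict : ∀ {a b R C h c} R′ C′ → Sized a b R C → R′ ⊆ₛ R → C′ ⊆ₛ C →
                   pivot R C ≡ (h , c) → R′ h ≡ true → C′ c ≡ true → pivot R′ C′ ≡ (h , c)
  pivot-restrict {R = R} {C} R′ C′ _ R′⊆R C′⊆C refl R′h C′c =
    firstSat-restrict (inBox R C) (inBox R′ C′) (L ++ allCells) sub (∧-true R′h C′c)
    where
    sub : ∀ y → inBox R′ C′ y ≡ true → inBox R C y ≡ true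
    sub (r , c) inside = ∧-true (R′⊆R r (∧-trueˡ inside)) (C′⊆C c (∧-trueʳ inside))

  support : ∀ a b R C {σ} → Sized a b R C → σ ∈ triang a b R C →
            ∀ x m → σ x m ≡ true → R x ≡ true × C m ≡ true
  support a b R C sz σ∈ x m σxm with pivot R C in eq
  ... | h , c with pivot∈box sz eq | step a b R C eq σ∈
  ... | Rh , Cc | base refl refl with addCell⁻ h c emptyV x m σxm
  ...   | inj₁ (refl , refl) = Rh , Cc
  support (suc a) b R C sz σ∈ x m σxm | h , c | Rh , Cc | row {σ = σ′} refl σ′∈ with addCell⁻ h c σ′ x m σxm
  ...   | inj₁ (refl , refl) = Rh , Cc
  ...   | inj₂ σ′xm = let Rx , Cm = support a b _ C (Sized-─row sz Rh) σ′∈ x m σ′xm in ─-⊆ R h x Rx , Cm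
  support a (suc b) R C sz σ∈ x m σxm | h , c | Rh , Cc | col {σ = σ′} refl σ′∈ with addCell⁻ h c σ′ x m σxm
  ...   | inj₁ (refl , refl) = Rh , Cc
  ...   | inj₂ σ′xm = let Rx , Cm = support a b R _ (Sized-─col sz Cc) σ′∈ x m σ′xm in Rx , ─-⊆ C c m Cm

  rowFree : ∀ a b R C h {σ} → Sized a b (R ─ h) C → σ ∈ triang a b (R ─ h) C → ∀ m → σ h m ≡ false
  rowFree a b R C h {σ} sz σ∈ m with σ h m in σhm
  ... | false = refl
  ... | true = ⊥-elim (false≢true (trans (sym (─-self R h)) (proj₁ (support a b (R ─ h) C sz σ∈ h m σhm))))

  colFree : ∀ a b R C c {σ} → Sized a b R (C ─ c) → σ ∈ triang a b R (C ─ c) → ∀ r → σ r c ≡ false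
  colFree a b R C c {σ} sz σ∈ r with σ r c in σrc
  ... | false = refl
  ... | true = ⊥-elim (false≢true (trans (sym (─-self C c)) (proj₂ (support a b R (C ─ c) sz σ∈ r c σrc))))

  singleRow-full : ∀ b R C {σ} → Sized zero b R C → σ ∈ triang zero b R C →
                   ∀ x m → R x ≡ true → C m ≡ true → σ x m ≡ true
  singleRow-full b R C sz σ∈ x m Rx Cm with pivot R C in eq
  ... | h , c with pivot∈box sz eq | step zero b R C eq σ∈
  ... | Rh , Cc | base _ refl =
    addCell-new′ h c emptyV (count≡1⇒unique R (proj₁ sz) Rh Rx) (count≡1⇒unique C (proj₂ sz) Cc Cm)
  singleRow-full (suc b) R C sz σ∈ x m Rx Cm | h , c | Rh , Cc | col {σ = σ′} refl σ′∈ with toSum (m ≟ c)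
  ... | inj₁ m≡c = addCell-new′ h c σ′ (count≡1⇒unique R (proj₁ sz) Rh Rx) m≡c
  ... | inj₂ m≢c = addCell-old h c σ′ x m
        (singleRow-full b R _ (Sized-─col sz Cc) σ′∈ x m Rx (trans (─-other C m≢c) Cm))

  singleCol-full : ∀ a R C {σ} → Sized a zero R C → σ ∈ triang a zero R C →
                   ∀ x m → R x ≡ true → C m ≡ true → σ x m ≡ true
  singleCol-full a R C sz σ∈ x m Rx Cm with pivot R C in eq
  ... | h , c with pivot∈box sz eq | step a zero R C eq σ∈
  ... | Rh , Cc | base refl _ =
    addCell-new′ h c emptyV (count≡1⇒unique R (proj₁ sz) Rh Rx) (count≡1⇒unique C (proj₂ sz) Cc Cm)
  singleCol-full (suc a) R C sz σ∈ x m Rx Cm | h , c | Rh , Cc | row {σ = σ′} refl σ′∈ with toSum (x ≟ h)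
  ... | inj₁ x≡h = addCell-new′ h c σ′ x≡h (count≡1⇒unique C (proj₂ sz) Cc Cm)
  ... | inj₂ x≢h = addCell-old h c σ′ x m
        (singleCol-full a _ C (Sized-─row sz Rh) σ′∈ x m (trans (─-other R x≢h) Rx) Cm)

  extendCol : ∀ a b R C c {σ} → Sized a b R (C ─ c) → C c ≡ true → σ ∈ triang a b R (C ─ c) →
              ∃ λ σ′ → σ′ ∈ triang a (suc b) R C × σ ⊆ᵥ σ′
  extendCol a b R C c {σ} sz Cc σ∈ with pivot R C in eq
  ... | h , c′ with c′ ≟ c | pivot∈box (Sized-─col⁻ sz Cc) eq
  ... | yes refl | _ = addCell (h , c′) σ , ∈-col a b R C eq σ∈ , addCell-old h c′ σ
  ... | no c′≢c | Rh , Cc′ with step a b R (C ─ c) eq′ σ∈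
    where
    eq′ : pivot R (C ─ c) ≡ (h , c′)
    eq′ = pivot-restrict R (C ─ c) (Sized-─col⁻ sz Cc) ⊆ₛ-refl (─-⊆ C c) eq Rh (trans (─-other C c′≢c) Cc′)
  ... | base refl refl =
        let τ , τ∈ = triang-nonempty zero zero R (C ─ c′) in
        addCell (h , c′) τ , ∈-col zero zero R C eq τ∈ , addCell-mono h c′ (emptyV-⊆ τ)
  ... | row {a′} refl σ₁∈ =
        let σ₁′ , σ₁′∈ , σ₁⊆ = extendCol a′ b (R ─ h) C c (Sized-─row sz Rh) Cc σ₁∈ in
        addCell (h , c′) σ₁′ , ∈-row a′ (suc b) R C eq σ₁′∈ , addCell-mono h c′ σ₁⊆
  ... | col {b′} refl σ₁∈ =
        let σ₁′ , σ₁′∈ , σ₁⊆ = extendCol a b′ R (C ─ c′) c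
              (Sized-cong (λ _ → refl) (─-comm C c c′) (Sized-─col sz (trans (─-other C c′≢c) Cc′)))
              (trans (─-other C (c′≢c ∘ sym)) Cc)
              (∈triang-cong a b′ (λ _ → refl) (─-comm C c c′) σ₁∈) in
        addCell (h , c′) σ₁′ , ∈-col a (suc b′) R C eq σ₁′∈ , addCell-mono h c′ σ₁⊆

  extendRow : ∀ a b R C r {σ} → Sized a b (R ─ r) C → R r ≡ true → σ ∈ triang a b (R ─ r) C →
              ∃ λ σ′ → σ′ ∈ triang (suc a) b R C × σ ⊆ᵥ σ′
  extendRow a b R C r {σ} sz Rr σ∈ with pivot R C in eq
  ... | h′ , c with h′ ≟ r | pivot∈box (Sized-─row⁻ sz Rr) eq
  ... | yes refl | _ = addCell (h′ , c) σ , ∈-row a b R C eq σ∈ , addCell-old h′ c σ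
  ... | no h′≢r | Rh′ , Cc with step a b (R ─ r) C eq′ σ∈
    where
    eq′ : pivot (R ─ r) C ≡ (h′ , c)
    eq′ = pivot-restrict (R ─ r) C (Sized-─row⁻ sz Rr) (─-⊆ R r) ⊆ₛ-refl eq (trans (─-other R h′≢r) Rh′) Cc
  ... | base refl refl =
        let τ , τ∈ = triang-nonempty zero zero (R ─ h′) C in
        addCell (h′ , c) τ , ∈-row zero zero R C eq τ∈ , addCell-mono h′ c (emptyV-⊆ τ)
  ... | col {b′} refl σ₁∈ =
        let σ₁′ , σ₁′∈ , σ₁⊆ = extendRow a b′ R (C ─ c) r (Sized-─col sz Cc) Rr σ₁∈ in
        addCell (h′ , c) σ₁′ , ∈-col (suc a) b′ R C eq σ₁′∈ , addCell-mono h′ c σ₁⊆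
  ... | row {a′} refl σ₁∈ =
        let σ₁′ , σ₁′∈ , σ₁⊆ = extendRow a′ b (R ─ h′) C r
              (Sized-cong (─-comm R r h′) (λ _ → refl) (Sized-─row sz (trans (─-other R h′≢r) Rh′)))
              (trans (─-other R (h′≢r ∘ sym)) Rr)
              (∈triang-cong a′ b (─-comm R r h′) (λ _ → refl) σ₁∈) in
        addCell (h′ , c) σ₁′ , ∈-row (suc a′) b R C eq σ₁′∈ , addCell-mono h′ c σ₁⊆

  restrictRow : ∀ a b R C r {σ} → Sized (suc a) b R C → R r ≡ true → σ ∈ triang (suc a) b R C →
                ∃ λ σ′ → σ′ ∈ triang a b (R ─ r) C × σ ⊆ᵥ σ′ offRow r
  restrictRow zero b R C r {σ} sz Rr σ∈ =
    let τ , τ∈ = triang-nonempty zero b (R ─ r) C in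
    τ , τ∈ , λ x m x≢r σxm → let Rx , Cm = support (suc zero) b R C sz σ∈ x m σxm in
      singleRow-full b (R ─ r) C (Sized-─row sz Rr) τ∈ x m (trans (─-other R x≢r) Rx) Cm
  restrictRow (suc a₁) b R C r {σ} sz Rr σ∈ with pivot R C in eq
  ... | h , c with pivot∈box sz eq | step (suc (suc a₁)) b R C eq σ∈
  ... | Rh , Cc | row {σ = σ₁} refl σ₁∈ with r ≟ h
  ...   | yes refl = σ₁ , σ₁∈ , λ x m x≢r e → addCell-offRow h c σ₁ e x≢r
  ...   | no r≢h =
    let σ₂ , σ₂∈ , σ₁⊆ = restrictRow a₁ b (R ─ h) C r (Sized-─row sz Rh) (trans (─-other R r≢h) Rr) σ₁∈ in
    addCell (h , c) σ₂ ,
    ∈-row a₁ b (R ─ r) C eq′ (∈triang-cong a₁ b (─-comm R h r) (λ _ → refl) σ₂∈) ,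
    addCell-mono-offRow h c σ₁⊆
    where
    eq′ : pivot (R ─ r) C ≡ (h , c)
    eq′ = pivot-restrict (R ─ r) C sz (─-⊆ R r) ⊆ₛ-refl eq (trans (─-other R (r≢h ∘ sym)) Rh) Cc
  restrictRow (suc a₁) b R C r {σ} sz Rr σ∈ | h , c | Rh , Cc | col {b′} {σ₁} refl σ₁∈
    with σ₂ , σ₂∈ , σ₁⊆ ← restrictRow (suc a₁) b′ R (C ─ c) r (Sized-─col sz Cc) Rr σ₁∈
    with r ≟ h
  ... | yes refl =
    let σ₃ , σ₃∈ , σ₂⊆ = extendCol (suc a₁) b′ (R ─ r) C c (Sized-─row (Sized-─col sz Cc) Rr) Cc σ₂∈ in
    σ₃ , σ₃∈ , λ x m x≢r e → σ₂⊆ x m (σ₁⊆ x m x≢r (addCell-offRow h c σ₁ e x≢r))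
  ... | no r≢h = addCell (h , c) σ₂ , ∈-col (suc a₁) b′ (R ─ r) C eq′ σ₂∈ , addCell-mono-offRow h c σ₁⊆
    where
    eq′ : pivot (R ─ r) C ≡ (h , c)
    eq′ = pivot-restrict (R ─ r) C sz (─-⊆ R r) ⊆ₛ-refl eq (trans (─-other R (r≢h ∘ sym)) Rh) Cc

  restrictCol : ∀ a b R C c {σ} → Sized a (suc b) R C → C c ≡ true → σ ∈ triang a (suc b) R C →
                ∃ λ σ′ → σ′ ∈ triang a b R (C ─ c) × σ ⊆ᵥ σ′ offCol c
  restrictCol a zero R C c {σ} sz Cc σ∈ =
    let τ , τ∈ = triang-nonempty a zero R (C ─ c) in
    τ , τ∈ , λ x m m≢c σxm → let Rx , Cm = support a (suc zero) R C sz σ∈ x m σxm in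
      singleCol-full a R (C ─ c) (Sized-─col sz Cc) τ∈ x m Rx (trans (─-other C m≢c) Cm)
  restrictCol a (suc b₁) R C c {σ} sz Cc σ∈ with pivot R C in eq
  ... | h , c′ with pivot∈box sz eq | step a (suc (suc b₁)) R C eq σ∈
  ... | Rh , Cc′ | col {σ = σ₁} refl σ₁∈ with c ≟ c′
  ...   | yes refl = σ₁ , σ₁∈ , λ x m m≢c e → addCell-offCol h c σ₁ e m≢c
  ...   | no c≢c′ =
    let σ₂ , σ₂∈ , σ₁⊆ = restrictCol a b₁ R (C ─ c′) c (Sized-─col sz Cc′) (trans (─-other C c≢c′) Cc) σ₁∈ in
    addCell (h , c′) σ₂ ,
    ∈-col a b₁ R (C ─ c) eq′ (∈triang-cong a b₁ (λ _ → refl) (─-comm C c′ c) σ₂∈) ,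
    addCell-mono-offCol h c′ σ₁⊆
    where
    eq′ : pivot R (C ─ c) ≡ (h , c′)
    eq′ = pivot-restrict R (C ─ c) sz ⊆ₛ-refl (─-⊆ C c) eq Rh (trans (─-other C (c≢c′ ∘ sym)) Cc′)
  restrictCol a (suc b₁) R C c {σ} sz Cc σ∈ | h , c′ | Rh , Cc′ | row {a′} {σ₁} refl σ₁∈
    with σ₂ , σ₂∈ , σ₁⊆ ← restrictCol a′ (suc b₁) (R ─ h) C c (Sized-─row sz Rh) Cc σ₁∈
    with c ≟ c′
  ... | yes refl =
    let σ₃ , σ₃∈ , σ₂⊆ = extendRow a′ (suc b₁) R (C ─ c) h (Sized-─col (Sized-─row sz Rh) Cc) Rh σ₂∈ in
    σ₃ , σ₃∈ , λ x m m≢c e → σ₂⊆ x m (σ₁⊆ x m m≢c (addCell-offCol h c σ₁ e m≢c))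
  ... | no c≢c′ = addCell (h , c′) σ₂ , ∈-row a′ (suc b₁) R (C ─ c) eq′ σ₂∈ , addCell-mono-offCol h c′ σ₁⊆
    where
    eq′ : pivot R (C ─ c) ≡ (h , c′)
    eq′ = pivot-restrict R (C ─ c) sz ⊆ₛ-refl (─-⊆ C c) eq Rh (trans (─-other C (c≢c′ ∘ sym)) Cc′)

module _ {n d : ℕ} where

  𝟎 : Weights n d
  𝟎 _ _ = 0ℚ

  setCell-𝟎 : ∀ h c r m → setCell 𝟎 h c 0ℚ r m ≡ 0ℚ
  setCell-𝟎 h c r m with r ≡ᵇ h ∧ m ≡ᵇ c
  ... | true  = refl
  ... | false = refl

  vanish-fromApex : ∀ w h c → w h c ≡ 0ℚ →
    (∀ r → rowSum w r ≡ 0ℚ) → (∀ m → colSum w m ≡ 0ℚ) →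
    ((∀ r → rowSum (setCell w h c 0ℚ) r ≡ 0ℚ) → (∀ m → colSum (setCell w h c 0ℚ) m ≡ 0ℚ) →
      ∀ r m → setCell w h c 0ℚ r m ≡ 0ℚ) →
    ∀ r m → w r m ≡ 0ℚ
  vanish-fromApex w h c apex rows cols base =
    ≗-fromZeroCell w 𝟎 h c apex (λ r m → trans (base rows′ cols′ r m) (sym (setCell-𝟎 h c r m)))
    where
    marg = zeroCell-Marginals≡ w 𝟎 h c apex
             ((λ r → trans (rows r) (sym (sumℚ-zero {d} _ (λ _ → refl)))) ,
              (λ m → trans (cols m) (sym (sumℚ-zero {n} _ (λ _ → refl)))))
    rows′ : ∀ r → rowSum (setCell w h c 0ℚ) r ≡ 0ℚ
    rows′ r = trans (proj₁ marg r) (sumℚ-zero _ (λ m → setCell-𝟎 h c r m))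
    cols′ : ∀ m → colSum (setCell w h c 0ℚ) m ≡ 0ℚ
    cols′ m = trans (proj₂ marg m) (sumℚ-zero _ (λ r → setCell-𝟎 h c r m))

  cardV-emptyV : cardV (emptyV {n} {d}) ≡ 0
  cardV-emptyV = sumℕ-zero {n} _ (λ _ → sumℕ-zero {d} _ (λ _ → refl))

  cardV-addCell : ∀ h c σ → σ h c ≡ false → cardV (addCell (h , c) σ) ≡ suc (cardV σ)
  cardV-addCell h c σ σhc≡false = begin
    cardV (addCell (h , c) σ)  ≡⟨ sumℕ-extract _ h ⟩
    rowCount (addCell (h , c) σ) h + others (addCell (h , c) σ)
      ≡⟨ cong₂ _+_ (trans (sumℕ-extract _ c) (cong₂ _+_ (cong 𝟙 (addCell-new h c σ)) (sumℕ-cong rowOffApex)))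
                   (sumℕ-cong othersSame) ⟩
    suc (restOfRow + others σ)  ≡⟨ cong (λ k → suc (k + others σ))
                                     (sym (trans (sumℕ-extract _ c) (cong (λ b → 𝟙 b + restOfRow) σhc≡false))) ⟩
    suc (rowCount σ h + others σ)  ≡⟨ cong suc (sym (sumℕ-extract _ h)) ⟩
    suc (cardV σ)  ∎
    where
    open ≡-Reasoning
    rowCount : VSet n d → Fin n → ℕ
    rowCount τ j = sumℕ (λ m → 𝟙 (τ j m))
    others : VSet n d → ℕ
    others τ = sumℕ (λ j → if j ≡ᵇ h then 0 else rowCount τ j)
    restOfRow = sumℕ (λ m → if m ≡ᵇ c then 0 else 𝟙 (σ h m))
    rowOffApex : ∀ m → (if m ≡ᵇ c then 0 else 𝟙 (addCell (h , c) σ h m)) ≡ (if m ≡ᵇ c then 0 else 𝟙 (σ h m))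
    rowOffApex m rewrite ≡ᵇ-refl h with m ≡ᵇ c
    ... | true  = refl
    ... | false = refl
    othersSame : ∀ j → (if j ≡ᵇ h then 0 else rowCount (addCell (h , c) σ) j) ≡ (if j ≡ᵇ h then 0 else rowCount σ j)
    othersSame j with j ≡ᵇ h
    ... | true  = refl
    ... | false = refl

module Maximal {n d : ℕ} (L : List (Fin n × Fin d)) (fallback : Fin n × Fin d) where

  open Pulling L fallback

  triang-affinelyIndependent : ∀ a b R C {σ} → Sized a b R C → σ ∈ triang a b R C → AffinelyIndependent σ
  triang-affinelyIndependent a b R C sz σ∈ w supp rows cols with pivot R C in eq
  ... | h , c with pivot∈box sz eq | step a b R C eq σ∈
  ... | _ | base refl refl =
    vanish-fromApex w h c (trans (sym (rowSum-apex w h c emptyV supp (λ _ → refl))) (rows h)) rows cols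
      (λ _ _ r m → zeroCell-supported w h c emptyV supp r m refl)
  ... | Rh , _ | row {a′} {σ₁} refl σ₁∈ =
    vanish-fromApex w h c (trans (sym (rowSum-apex w h c σ₁ supp (rowFree a′ b R C h sz′ σ₁∈))) (rows h)) rows cols
      (triang-affinelyIndependent a′ b (R ─ h) C sz′ σ₁∈ _ (zeroCell-supported w h c σ₁ supp))
    where sz′ = Sized-─row sz Rh
  ... | _ , Cc | col {b′} {σ₁} refl σ₁∈ =
    vanish-fromApex w h c (trans (sym (colSum-apex w h c σ₁ supp (colFree a b′ R C c sz′ σ₁∈))) (cols c)) rows cols
      (triang-affinelyIndependent a b′ R (C ─ c) sz′ σ₁∈ _ (zeroCell-supported w h c σ₁ supp))
    where sz′ = Sized-─col sz Cc

  triang-cardV : ∀ a b R C {σ} → Sized a b R C → σ ∈ triang a b R C → cardV σ ≡ suc (a + b)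
  triang-cardV a b R C sz σ∈ with pivot R C in eq
  ... | h , c with pivot∈box sz eq | step a b R C eq σ∈
  ... | _ | base refl refl = trans (cardV-addCell h c emptyV refl) (cong suc (cardV-emptyV {n} {d}))
  ... | Rh , _ | row {a′} {σ₁} refl σ₁∈ =
    trans (cardV-addCell h c σ₁ (rowFree a′ b R C h sz′ σ₁∈ c)) (cong suc (triang-cardV a′ b _ C sz′ σ₁∈))
    where sz′ = Sized-─row sz Rh
  ... | _ , Cc | col {b′} {σ₁} refl σ₁∈ =
    trans (cardV-addCell h c σ₁ (colFree a b′ R C c sz′ σ₁∈ h))
      (cong suc (trans (triang-cardV a b′ R _ sz′ σ₁∈) (sym (ℕₚ.+-suc a b′))))
    where sz′ = Sized-─col sz Cc

module Coherence {n d : ℕ} (L : List (Fin n × Fin d)) (fallback : Fin n × Fin d) where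

  open Pulling L fallback

  Coherent : VSet n d → VSet n d → Set
  Coherent σ τ = ∀ w w′ → NonNeg w → NonNeg w′ → SupportedOn σ w → SupportedOn τ w′ → Marginals≡ w w′ →
                 ∀ r m → w r m ≡ w′ r m

  emptyV-coherent : Coherent emptyV emptyV
  emptyV-coherent w w′ _ _ supp supp′ _ r m = trans (supp r m refl) (sym (supp′ r m refl))

  coherent-cone : ∀ {h c σ τ} → Coherent σ τ →
    (∀ w w′ → SupportedOn (addCell (h , c) σ) w → SupportedOn (addCell (h , c) τ) w′ → Marginals≡ w w′ →
      w h c ≡ w′ h c) →
    Coherent (addCell (h , c) σ) (addCell (h , c) τ)
  coherent-cone {h} {c} {σ} {τ} σ~τ apex w w′ w≥0 w′≥0 supp supp′ marg =
    ≗-fromZeroCell w w′ h c apex-hc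
      (σ~τ _ _ (setCell-nonneg w h c 0ℚ w≥0 ℚₚ.≤-refl) (setCell-nonneg w′ h c 0ℚ w′≥0 ℚₚ.≤-refl)
        (zeroCell-supported w h c σ supp) (zeroCell-supported w′ h c τ supp′)
        (zeroCell-Marginals≡ w w′ h c apex-hc marg))
    where apex-hc = apex w w′ supp supp′ marg

  apexRow : ∀ h c (σ τ : VSet n d) → (∀ m → σ h m ≡ false) → (∀ m → τ h m ≡ false) →
    ∀ w w′ → SupportedOn (addCell (h , c) σ) w → SupportedOn (addCell (h , c) τ) w′ → Marginals≡ w w′ → w h c ≡ w′ h c
  apexRow h c σ τ σ-free τ-free w w′ supp supp′ (rows , _) =
    trans (sym (rowSum-apex w h c σ supp σ-free)) (trans (rows h) (rowSum-apex w′ h c τ supp′ τ-free))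

  apexCol : ∀ h c (σ τ : VSet n d) → (∀ r → σ r c ≡ false) → (∀ r → τ r c ≡ false) →
    ∀ w w′ → SupportedOn (addCell (h , c) σ) w → SupportedOn (addCell (h , c) τ) w′ → Marginals≡ w w′ → w h c ≡ w′ h c
  apexCol h c σ τ σ-free τ-free w w′ supp supp′ (_ , cols) =
    trans (sym (colSum-apex w h c σ supp σ-free)) (trans (cols c) (colSum-apex w′ h c τ supp′ τ-free))

  -- Coherence of any two simplices gives conv σ ∩ conv τ = conv (σ ∩ τ).
  mutual
    triang-coherent : ∀ a b R C {σ τ} → Sized a b R C → σ ∈ triang a b R C → τ ∈ triang a b R C → Coherent σ τ
    triang-coherent a b R C sz σ∈ τ∈ with pivot R C in eq
    ... | h , c with pivot∈box sz eq | step a b R C eq σ∈ | step a b R C eq τ∈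
    ... | _ | base refl refl | base _ _ =
      coherent-cone emptyV-coherent (apexRow h c emptyV emptyV (λ _ → refl) (λ _ → refl))
    ... | Rh , _ | row {a′} {σ₁} refl σ₁∈ | row {σ = τ₁} refl τ₁∈ =
      coherent-cone (triang-coherent a′ b (R ─ h) C sz′ σ₁∈ τ₁∈)
        (apexRow h c σ₁ τ₁ (rowFree a′ b R C h sz′ σ₁∈) (rowFree a′ b R C h sz′ τ₁∈))
      where sz′ = Sized-─row sz Rh
    ... | _ , Cc | col {b′} {σ₁} refl σ₁∈ | col {σ = τ₁} refl τ₁∈ =
      coherent-cone (triang-coherent a b′ R (C ─ c) sz′ σ₁∈ τ₁∈)
        (apexCol h c σ₁ τ₁ (colFree a b′ R C c sz′ σ₁∈) (colFree a b′ R C c sz′ τ₁∈))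
      where sz′ = Sized-─col sz Cc
    ... | Rh , Cc | row {a′} refl σ₁∈ | col {b′} refl τ₁∈ = coherent-rowCol a′ b′ R C h c sz Rh Cc σ₁∈ τ₁∈
    ... | Rh , Cc | col {b′} refl σ₁∈ | row {a′} refl τ₁∈ = λ w w′ w≥0 w′≥0 supp supp′ (rows , cols) r m →
      sym (coherent-rowCol a′ b′ R C h c sz Rh Cc τ₁∈ σ₁∈ w′ w w′≥0 w≥0 supp′ supp
             ((λ r → sym (rows r)) , (λ m → sym (cols m))) r m)

    -- The apex weight is the whole row sum on one side and the whole column sum on the other,
    -- so non-negativity forces equality; both remaining weights then live on Δ_{R─h} × Δ_{C─c}.
    coherent-rowCol : ∀ a′ b′ R C h c {σ₁ τ₁} → Sized (suc a′) (suc b′) R C → R h ≡ true → C c ≡ true →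
      σ₁ ∈ triang a′ (suc b′) (R ─ h) C → τ₁ ∈ triang (suc a′) b′ R (C ─ c) →
      Coherent (addCell (h , c) σ₁) (addCell (h , c) τ₁)
    coherent-rowCol a′ b′ R C h c {σ₁} {τ₁} sz Rh Cc σ₁∈ τ₁∈ w w′ w≥0 w′≥0 supp supp′ marg@(rows , cols) =
      ≗-fromZeroCell w w′ h c apex
        (triang-coherent a′ b′ (R ─ h) (C ─ c) (Sized-─col szσ Cc) σ₂∈ τ₂∈ w₀ w₀′
          (setCell-nonneg w h c 0ℚ w≥0 ℚₚ.≤-refl) (setCell-nonneg w′ h c 0ℚ w′≥0 ℚₚ.≤-refl)
          (offCol-supported w₀ c (zeroCell-supported w h c σ₁ supp) σ₁⊆ emptyCol)
          (offRow-supported w₀′ h (zeroCell-supported w′ h c τ₁ supp′) τ₁⊆ emptyRow)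
          (zeroCell-Marginals≡ w w′ h c apex marg))
      where
      szσ = Sized-─row sz Rh
      szτ = Sized-─col sz Cc
      w₀ = setCell w h c 0ℚ
      w₀′ = setCell w′ h c 0ℚ
      rowApex : rowSum w h ≡ w h c
      rowApex = rowSum-apex w h c σ₁ supp (rowFree a′ (suc b′) R C h szσ σ₁∈)
      colApex : colSum w′ c ≡ w′ h c
      colApex = colSum-apex w′ h c τ₁ supp′ (colFree (suc a′) b′ R C c szτ τ₁∈)
      apex : w h c ≡ w′ h c
      apex = ℚₚ.≤-antisym
        (subst (w h c ℚ.≤_) (trans (cols c) colApex) (term≤sumℚ (λ r → w r c) (λ r → w≥0 r c) h))
        (subst (w′ h c ℚ.≤_) (trans (sym (rows h)) rowApex) (term≤sumℚ (w′ h) (w′≥0 h) c))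
      emptyCol : ∀ r → w₀ r c ≡ 0ℚ
      emptyCol = sumℚ≡0⇒zero (λ r → w₀ r c) (λ r → setCell-nonneg w h c 0ℚ w≥0 ℚₚ.≤-refl r c)
                   (zeroCell-emptyCol w h c (trans (cols c) (trans colApex (sym apex))))
      emptyRow : ∀ m → w₀′ h m ≡ 0ℚ
      emptyRow = sumℚ≡0⇒zero (w₀′ h) (setCell-nonneg w′ h c 0ℚ w′≥0 ℚₚ.≤-refl h)
                   (zeroCell-emptyRow w′ h c (trans (sym (rows h)) (trans rowApex apex)))
      σ₂∈ = proj₁ (proj₂ (restrictCol a′ b′ (R ─ h) C c szσ Cc σ₁∈))
      σ₁⊆ = proj₂ (proj₂ (restrictCol a′ b′ (R ─ h) C c szσ Cc σ₁∈))
      τ₂∈ = proj₁ (proj₂ (restrictRow a′ b′ R (C ─ c) h szτ Rh τ₁∈))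
      τ₁⊆ = proj₂ (proj₂ (restrictRow a′ b′ R (C ─ c) h szτ Rh τ₁∈))

p≤q⇒0≤q-p : ∀ {p q} → p ℚ.≤ q → 0ℚ ℚ.≤ q ℚ.- p
p≤q⇒0≤q-p {p} {q} p≤q = subst (ℚ._≤ q ℚ.- p) (ℚₚ.+-inverseʳ p) (ℚₚ.+-monoˡ-≤ (ℚ.- p) p≤q)

module _ {k : ℕ} where

  shrink : (Fin k → ℚ) → Fin k → ℚ → Fin k → ℚ
  shrink p h v = p [ h ]≔ (p h ℚ.- v)

  sumℚ-shrink : ∀ p h v → sumℚ (shrink p h v) ≡ sumℚ p ℚ.- v
  sumℚ-shrink p h v = trans (sumℚ-update p h (p h ℚ.- v))
    (solve 3 (λ s x v → s :+ ((x :- v) :- x) := s :- v) refl (sumℚ p) (p h) v)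
    where open ℚ-Solver

  shrink-nonneg : ∀ p h v → (∀ r → 0ℚ ℚ.≤ p r) → v ℚ.≤ p h → ∀ r → 0ℚ ℚ.≤ shrink p h v r
  shrink-nonneg p h v p≥0 v≤ r with r ≡ᵇ h
  ... | true  = p≤q⇒0≤q-p v≤
  ... | false = p≥0 r

  shrink-restore : ∀ p h v r → shrink p h v r ℚ.+ (if r ≡ᵇ h then v ℚ.- 0ℚ else 0ℚ) ≡ p r
  shrink-restore p h v r with toSum (r ≟ h)
  ... | inj₁ refl rewrite ≡ᵇ-refl r = solve 2 (λ x v → (x :- v) :+ (v :- con 0ℚ) := x) refl (p r) v
    where open ℚ-Solver
  ... | inj₂ r≢h rewrite ≢⇒≡ᵇ-false r≢h = ℚₚ.+-identityʳ (p r)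

  shrink-all : ∀ p h → shrink p h (p h) h ≡ 0ℚ
  shrink-all p h = trans ([]≔-here p h _) (ℚₚ.+-inverseʳ (p h))

  shrink-offBox : ∀ (S : Sub k) p h v → (∀ r → S r ≡ false → p r ≡ 0ℚ) → S h ≡ true →
                  ∀ r → S r ≡ false → shrink p h v r ≡ 0ℚ
  shrink-offBox S p h v p-off Sh r Sr = trans ([]≔-other p _ r≢h) (p-off r Sr)
    where
    r≢h : ¬ r ≡ h
    r≢h refl = false≢true (trans (sym Sr) Sh)

  shrink-offBox─ : ∀ (S : Sub k) p h v → (∀ r → S r ≡ false → p r ≡ 0ℚ) → p h ≡ v →
                   ∀ r → (S ─ h) r ≡ false → shrink p h v r ≡ 0ℚ
  shrink-offBox─ S p h v p-off ph≡v r S─h with toSum (r ≟ h)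
  ... | inj₁ refl = subst (λ u → shrink p r u r ≡ 0ℚ) ph≡v (shrink-all p r)
  ... | inj₂ r≢h = trans ([]≔-other p _ r≢h) (p-off r (trans (sym (─-other S r≢h)) S─h))

module Cover {n d : ℕ} (L : List (Fin n × Fin d)) (fallback : Fin n × Fin d) where

  open Pulling L fallback

  -- Marginals p, q of a point of Δ_R × Δ_C, up to a common scaling.
  record Feasible (R : Sub n) (C : Sub d) (p : Fin n → ℚ) (q : Fin d → ℚ) : Set where
    field
      p≥0 : ∀ r → 0ℚ ℚ.≤ p r
      q≥0 : ∀ c → 0ℚ ℚ.≤ q c
      p-offBox : ∀ r → R r ≡ false → p r ≡ 0ℚ
      q-offBox : ∀ c → C c ≡ false → q c ≡ 0ℚ
      balanced : sumℚ p ≡ sumℚ q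

  PlanOn : VSet n d → (Fin n → ℚ) → (Fin d → ℚ) → Set
  PlanOn σ p q = Σ (Weights n d) λ w →
    NonNeg w × SupportedOn σ w × (∀ j → rowSum w j ≡ p j) × (∀ m → colSum w m ≡ q m)

  plan-addCell : ∀ σ h c p q v → σ h c ≡ false → 0ℚ ℚ.≤ v →
                 PlanOn σ (shrink p h v) (shrink q c v) → PlanOn (addCell (h , c) σ) p q
  plan-addCell σ h c p q v σhc v≥0 (w , w≥0 , supp , rows , cols) =
    setCell w h c v , setCell-nonneg w h c v w≥0 v≥0 , setCell-supported w h c v σ supp ,
    (λ r → trans (rowSum-setCell w h c v r)
             (trans (cong₂ (λ s t → s ℚ.+ (if r ≡ᵇ h then v ℚ.- t else 0ℚ)) (rows r) (supp h c σhc))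
                    (shrink-restore p h v r))) ,
    (λ m → trans (colSum-setCell w h c v m)
             (trans (cong₂ (λ s t → s ℚ.+ (if m ≡ᵇ c then v ℚ.- t else 0ℚ)) (cols m) (supp h c σhc))
                    (shrink-restore q c v m)))

  -- Northwest-corner rule: load the pivot with as much as its row and column allow.
  triang-covers : ∀ a b R C p q → Sized a b R C → Feasible R C p q → Any (λ σ → PlanOn σ p q) (triang a b R C)
  triang-covers a b R C p q sz feas with pivot R C in eq
  ... | h , c with pivot∈box sz eq
  ... | Rh , Cc = go a b sz
    where
    open Feasible feas

    shrink-balanced : ∀ v → sumℚ (shrink p h v) ≡ sumℚ (shrink q c v)
    shrink-balanced v = trans (sumℚ-shrink p h v) (trans (cong (ℚ._- v) balanced) (sym (sumℚ-shrink q c v)))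

    rowStep : ∀ a′ b → Sized (suc a′) b R C → p h ℚ.≤ q c → Any (λ σ → PlanOn σ p q) (triang (suc a′) b R C)
    rowStep a′ b sz ph≤qc =
      let σ₁ , σ₁∈ , plan = find (triang-covers a′ b (R ─ h) C _ _ sz′ feas′) in
      lose (∈-row a′ b R C eq σ₁∈) (plan-addCell σ₁ h c p q (p h) (rowFree a′ b R C h sz′ σ₁∈ c) (p≥0 h) plan)
      where
      sz′ = Sized-─row sz Rh
      feas′ : Feasible (R ─ h) C (shrink p h (p h)) (shrink q c (p h))
      feas′ = record
        { p≥0 = shrink-nonneg p h (p h) p≥0 ℚₚ.≤-refl
        ; q≥0 = shrink-nonneg q c (p h) q≥0 ph≤qc
        ; p-offBox = shrink-offBox─ R p h (p h) p-offBox refl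
        ; q-offBox = shrink-offBox C q c (p h) q-offBox Cc
        ; balanced = shrink-balanced (p h)
        }

    colStep : ∀ a b′ → Sized a (suc b′) R C → q c ℚ.≤ p h → Any (λ σ → PlanOn σ p q) (triang a (suc b′) R C)
    colStep a b′ sz qc≤ph =
      let σ₁ , σ₁∈ , plan = find (triang-covers a b′ R (C ─ c) _ _ sz′ feas′) in
      lose (∈-col a b′ R C eq σ₁∈) (plan-addCell σ₁ h c p q (q c) (colFree a b′ R C c sz′ σ₁∈ h) (q≥0 c) plan)
      where
      sz′ = Sized-─col sz Cc
      feas′ : Feasible R (C ─ c) (shrink p h (q c)) (shrink q c (q c))
      feas′ = record
        { p≥0 = shrink-nonneg p h (q c) p≥0 qc≤ph
        ; q≥0 = shrink-nonneg q c (q c) q≥0 ℚₚ.≤-refl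
        ; p-offBox = shrink-offBox R p h (q c) p-offBox Rh
        ; q-offBox = shrink-offBox─ C q c (q c) q-offBox refl
        ; balanced = shrink-balanced (q c)
        }

    sumℚp≡ph : count R ≡ 1 → sumℚ p ≡ p h
    sumℚp≡ph #R = sumℚ-single p h (λ r r≢h → p-offBox r (count≡1⇒only R #R Rh r≢h))

    sumℚq≡qc : count C ≡ 1 → sumℚ q ≡ q c
    sumℚq≡qc #C = sumℚ-single q c (λ m m≢c → q-offBox m (count≡1⇒only C #C Cc m≢c))

    go : ∀ a b → Sized a b R C → Any (λ σ → PlanOn σ p q) (triang a b R C)
    go (suc a′) (suc b′) sz with ℚₚ.≤-total (p h) (q c)
    ... | inj₁ ph≤qc = rowStep a′ (suc b′) sz ph≤qc
    ... | inj₂ qc≤ph = colStep (suc a′) b′ sz qc≤ph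
    go (suc a′) zero sz =
      rowStep a′ zero sz (subst (p h ℚ.≤_) (trans balanced (sumℚq≡qc (proj₂ sz))) (term≤sumℚ p p≥0 h))
    go zero (suc b′) sz =
      colStep zero b′ sz (subst (q c ℚ.≤_) (trans (sym balanced) (sumℚp≡ph (proj₁ sz))) (term≤sumℚ q q≥0 c))
    go zero zero (#R , #C) =
      lose (∈-base R C eq) (plan-addCell emptyV h c p q (p h) refl (p≥0 h)
        (𝟎 , (λ _ _ → ℚₚ.≤-refl) , (λ _ _ _ → refl) ,
         (λ r → trans (sumℚ-zero {d} _ (λ _ → refl)) (sym (emptyRest R p h (p h) p-offBox refl Rh #R r))) ,
         (λ m → trans (sumℚ-zero {n} _ (λ _ → refl)) (sym (emptyRest C q c (p h) q-offBox qc≡ph Cc #C m)))))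
      where
      qc≡ph : q c ≡ p h
      qc≡ph = trans (sym (sumℚq≡qc #C)) (trans (sym balanced) (sumℚp≡ph #R))
      emptyRest : ∀ {k} (S : Sub k) f x v → (∀ r → S r ≡ false → f r ≡ 0ℚ) → f x ≡ v →
                  S x ≡ true → count S ≡ 1 → ∀ r → shrink f x v r ≡ 0ℚ
      emptyRest S f x v f-off fx≡v Sx #S r = shrink-offBox─ S f x v f-off fx≡v r
        (count≡0⇒empty (S ─ x) (ℕₚ.suc-injective (trans (sym (count-─ S x Sx)) #S)) r)

module PullingTriangulation {n d : ℕ} (L : List (Fin (suc n) × Fin (suc d))) where

  open Pulling L (zero , zero)
  open Maximal L (zero , zero)
  open Coherence L (zero , zero)
  open Cover L (zero , zero)

  sized-full : Sized n d full full
  sized-full = count-full (suc n) , count-full (suc d)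

  pullingTriangulation : List (VSet (suc n) (suc d))
  pullingTriangulation = triang n d full full

  isTriangulation : IsTriangulation pullingTriangulation
  isTriangulation = All.tabulate maximal , covers , faceToFace
    where
    maximal : ∀ {σ} → σ ∈ pullingTriangulation → MaxSimplex σ
    maximal σ∈ = triang-affinelyIndependent n d full full sized-full σ∈ ,
                 trans (triang-cardV n d full full sized-full σ∈) (sym (ℕₚ.+-suc n d))
    covers : ∀ p q → InPolytope p q → Any (λ σ → InHull σ p q) pullingTriangulation
    covers p q (p≥0 , Σp≡1 , q≥0 , Σq≡1) =
      Any.map (λ (w , w≥0 , supp , rows , cols) → w , w≥0 , supp , trans (sumℚ-cong rows) Σp≡1 , rows , cols)
        (triang-covers n d full full p q sized-full (record
          { p≥0 = p≥0 ; q≥0 = q≥0 ; p-offBox = λ _ () ; q-offBox = λ _ () ; balanced = trans Σp≡1 (sym Σq≡1) }))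
    faceToFace : ∀ σ τ → σ ∈ pullingTriangulation → τ ∈ pullingTriangulation →
                 ∀ p q → InHull σ p q → InHull τ p q → InHull (σ ∩ᵥ τ) p q
    faceToFace σ τ σ∈ τ∈ p q (w , w≥0 , supp , total , rows , cols) (w′ , w′≥0 , supp′ , _ , rows′ , cols′) =
      w , w≥0 , supp∩ , total , rows , cols
      where
      w≗w′ = triang-coherent n d full full sized-full σ∈ τ∈ w w′ w≥0 w′≥0 supp supp′
               ((λ r → trans (rows r) (sym (rows′ r))) , (λ m → trans (cols m) (sym (cols′ m))))
      supp∩ : SupportedOn (σ ∩ᵥ τ) w
      supp∩ j m σ∩τ with σ j m in σjm
      ... | false = supp j m σjm
      ... | true  = trans (w≗w′ j m) (supp′ j m σ∩τ)

-- Unmixed simplices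

module _ {n d : ℕ} (j : Fin n) where

  unmixedPos-addCell-own : ∀ c (σ : VSet n d) m → unmixedPos (addCell (j , c) σ) j m ≡ unmixedPos σ j m
  unmixedPos-addCell-own c σ m = sumℕ-cong same
    where
    same : ∀ k → (if k ≡ᵇ j then 0 else 𝟙 (addCell (j , c) σ k m)) ≡ (if k ≡ᵇ j then 0 else 𝟙 (σ k m))
    same k with k ≡ᵇ j
    ... | true  = refl
    ... | false = refl

  unmixedPos-addCell-other : ∀ h c (σ : VSet n d) m → ¬ h ≡ j → σ h c ≡ false →
    unmixedPos (addCell (h , c) σ) j m ≡ unmixedPos σ j m + 𝟙 (m ≡ᵇ c)
  unmixedPos-addCell-other h c σ m h≢j σhc = begin
    unmixedPos (addCell (h , c) σ) j m           ≡⟨ sumℕ-extract _ h ⟩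
    at (addCell (h , c) σ) h + rest (addCell (h , c) σ)  ≡⟨ cong₂ _+_ atNew (sumℕ-cong restSame) ⟩
    (𝟙 (σ h m) + 𝟙 (m ≡ᵇ c)) + rest σ            ≡⟨ ℕₚ.+-assoc (𝟙 (σ h m)) _ _ ⟩
    𝟙 (σ h m) + (𝟙 (m ≡ᵇ c) + rest σ)            ≡⟨ cong (𝟙 (σ h m) +_) (ℕₚ.+-comm (𝟙 (m ≡ᵇ c)) _) ⟩
    𝟙 (σ h m) + (rest σ + 𝟙 (m ≡ᵇ c))            ≡⟨ ℕₚ.+-assoc (𝟙 (σ h m)) _ _ ⟨
    (𝟙 (σ h m) + rest σ) + 𝟙 (m ≡ᵇ c)            ≡⟨ cong (λ k → (k + rest σ) + 𝟙 (m ≡ᵇ c)) atOld ⟨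
    (at σ h + rest σ) + 𝟙 (m ≡ᵇ c)               ≡⟨ cong (_+ 𝟙 (m ≡ᵇ c)) (sumℕ-extract _ h) ⟨
    unmixedPos σ j m + 𝟙 (m ≡ᵇ c)                ∎
    where
    open ≡-Reasoning
    at : VSet n d → Fin n → ℕ
    at τ k = if k ≡ᵇ j then 0 else 𝟙 (τ k m)
    rest : VSet n d → ℕ
    rest τ = sumℕ (λ k → if k ≡ᵇ h then 0 else at τ k)
    atOld : at σ h ≡ 𝟙 (σ h m)
    atOld rewrite ≢⇒≡ᵇ-false h≢j = refl
    atNew : at (addCell (h , c) σ) h ≡ 𝟙 (σ h m) + 𝟙 (m ≡ᵇ c)
    atNew rewrite ≢⇒≡ᵇ-false h≢j | ≡ᵇ-refl h with toSum (m ≟ c)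
    ... | inj₁ refl rewrite ≡ᵇ-refl m | σhc = refl
    ... | inj₂ m≢c rewrite ≢⇒≡ᵇ-false m≢c = sym (ℕₚ.+-identityʳ _)
    restSame : ∀ k → (if k ≡ᵇ h then 0 else at (addCell (h , c) σ) k) ≡ (if k ≡ᵇ h then 0 else at σ k)
    restSame k with k ≡ᵇ h
    ... | true  = refl
    ... | false = refl

module UnmixedSteps {n d : ℕ} (L : List (Fin n × Fin d)) (fallback : Fin n × Fin d) (j : Fin n) where

  open Pulling L fallback

  UnmixedIn : VSet n d → Sub n → Sub d → (Fin d → ℕ) → Set
  UnmixedIn σ R C pos =
    (∀ m → C m ≡ true → σ j m ≡ true) ×
    (∀ k → ¬ k ≡ j → R k ≡ true → ∃ λ m → σ k m ≡ true × (∀ m′ → σ k m′ ≡ true → m′ ≡ m)) ×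
    (∀ m → unmixedPos σ j m ≡ pos m)

  UnmixedIn-pos : ∀ {σ R C pos pos′} → (∀ m → pos m ≡ pos′ m) → UnmixedIn σ R C pos → UnmixedIn σ R C pos′
  UnmixedIn-pos pos≗ (row-j , single , at) = row-j , single , λ m → trans (at m) (pos≗ m)

  unmixed-rowStep : ∀ a′ b R C h c pos → Sized (suc a′) b R C → pivot R C ≡ (h , c) → ¬ h ≡ j →
    Any (λ σ → UnmixedIn σ (R ─ h) C pos) (triang a′ b (R ─ h) C) →
    Any (λ σ → UnmixedIn σ R C (λ m → pos m + 𝟙 (m ≡ᵇ c))) (triang (suc a′) b R C)
  unmixed-rowStep a′ b R C h c pos sz eq h≢j found =
    let σ₁ , σ₁∈ , (row-j , single , at) = find found in
    lose (∈-row a′ b R C eq σ₁∈)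
      ((λ m Cm → addCell-old h c σ₁ j m (row-j m Cm)) ,
       single′ σ₁ σ₁∈ single ,
       (λ m → trans (unmixedPos-addCell-other j h c σ₁ m h≢j (rowFree a′ b R C h sz′ σ₁∈ c)) (cong (_+ _) (at m))))
    where
    sz′ = Sized-─row sz (proj₁ (pivot∈box sz eq))
    single′ : ∀ σ₁ → σ₁ ∈ triang a′ b (R ─ h) C →
      (∀ k → ¬ k ≡ j → (R ─ h) k ≡ true → ∃ λ m → σ₁ k m ≡ true × (∀ m′ → σ₁ k m′ ≡ true → m′ ≡ m)) →
      ∀ k → ¬ k ≡ j → R k ≡ true →
      ∃ λ m → addCell (h , c) σ₁ k m ≡ true × (∀ m′ → addCell (h , c) σ₁ k m′ ≡ true → m′ ≡ m)
    single′ σ₁ σ₁∈ single k k≢j Rk with toSum (k ≟ h)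
    ... | inj₁ refl = c , addCell-new k c σ₁ , only
      where
      only : ∀ m′ → addCell (k , c) σ₁ k m′ ≡ true → m′ ≡ c
      only m′ e with addCell⁻ k c σ₁ k m′ e
      ... | inj₁ (_ , m′≡c) = m′≡c
      ... | inj₂ σ₁km′ = ⊥-elim (false≢true (trans (sym (rowFree a′ b R C k sz′ σ₁∈ m′)) σ₁km′))
    ... | inj₂ k≢h =
      let m , σ₁km , only = single k k≢j (trans (─-other R k≢h) Rk) in
      m , addCell-old h c σ₁ k m σ₁km , λ m′ e → only m′ (addCell-offRow h c σ₁ e k≢h)

  unmixed-colStep : ∀ a b′ R C c pos → pivot R C ≡ (j , c) →
    Any (λ σ → UnmixedIn σ R (C ─ c) pos) (triang a b′ R (C ─ c)) →
    Any (λ σ → UnmixedIn σ R C pos) (triang a (suc b′) R C)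
  unmixed-colStep a b′ R C c pos eq found =
    let σ₁ , σ₁∈ , (row-j , single , at) = find found in
    lose (∈-col a b′ R C eq σ₁∈)
      (row-j′ σ₁ row-j ,
       (λ k k≢j Rk → let m , σ₁km , only = single k k≢j Rk in
          m , addCell-old j c σ₁ k m σ₁km , λ m′ e → only m′ (addCell-offRow j c σ₁ e k≢j)) ,
       (λ m → trans (unmixedPos-addCell-own j c σ₁ m) (at m)))
    where
    row-j′ : ∀ σ₁ → (∀ m → (C ─ c) m ≡ true → σ₁ j m ≡ true) → ∀ m → C m ≡ true → addCell (j , c) σ₁ j m ≡ true
    row-j′ σ₁ row-j m Cm with toSum (m ≟ c)
    ... | inj₁ refl = addCell-new j m σ₁
    ... | inj₂ m≢c = addCell-old j c σ₁ j m (row-j m (trans (─-other C m≢c) Cm))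

  unmixed-base : ∀ R C c → Sized zero zero R C → pivot R C ≡ (j , c) →
    Any (λ σ → UnmixedIn σ R C (λ _ → 0)) (triang zero zero R C)
  unmixed-base R C c sz eq =
    lose (∈-base R C eq)
      ((λ m Cm → addCell-new′ j c emptyV refl (count≡1⇒unique C (proj₂ sz) Cc Cm)) ,
       (λ k k≢j Rk → ⊥-elim (k≢j (count≡1⇒unique R (proj₁ sz) Rj Rk))) ,
       (λ m → trans (unmixedPos-addCell-own j c emptyV m) (sumℕ-zero _ (none m))))
    where
    Rj = proj₁ (pivot∈box sz eq)
    Cc = proj₂ (pivot∈box sz eq)
    none : ∀ m k → (if k ≡ᵇ j then 0 else 𝟙 (emptyV k m)) ≡ 0
    none m k with k ≡ᵇ j
    ... | true  = refl
    ... | false = refl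

Schedule : ℕ → ℕ → Set
Schedule n d = List (Fin d × List (Fin n))

module _ {n d : ℕ} where

  cells : Schedule n d → List (Fin n × Fin d)
  cells [] = []
  cells ((c , P) ∷ rest) = map (_, c) P ++ cells rest

  columns : Schedule n d → List (Fin d)
  columns = map proj₁

  cells-++ : ∀ pre rest → cells (pre ++ rest) ≡ cells pre ++ cells rest
  cells-++ [] rest = refl
  cells-++ ((c , P) ∷ pre) rest rewrite cells-++ pre rest =
    sym (Listₚ.++-assoc (map (_, c) P) (cells pre) (cells rest))

-- Pulling with the cells listed column by column: in the box {j} ∪ S × C the pivot is found
-- in the first column of C, so the rows before j there are deleted one by one until j is reached.
module ColumnMajor {n d : ℕ} (sched : Schedule n d) (fallback : Fin n × Fin d) (j : Fin n) (vj : Fin d → ℕ) where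

  open Pulling (cells sched) fallback
  open UnmixedSteps (cells sched) fallback j

  firstSat-skip : ∀ P xs ys → (∀ y → y ∈ xs → P y ≡ false) → firstSat P (xs ++ ys) ≡ firstSat P ys
  firstSat-skip P [] ys _ = refl
  firstSat-skip P (x ∷ xs) ys none rewrite none x (here refl) = firstSat-skip P xs ys (λ y y∈ → none y (there y∈))

  firstSat-column : ∀ R C c Y Z tail → C c ≡ true → R j ≡ true →
    ∃ λ h → firstSat (inBox R C) (map (_, c) (Y ++ j ∷ Z) ++ tail) ≡ (h , c) ×
            ((h ∈ Y × R h ≡ true) ⊎ (h ≡ j × (∀ x → x ∈ Y → R x ≡ false)))
  firstSat-column R C c [] Z tail Cc Rj rewrite Rj | Cc = j , refl , inj₂ (refl , λ _ ())
  firstSat-column R C c (y ∷ Y) Z tail Cc Rj with R y in Ry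
  ... | true rewrite Cc = y , refl , inj₁ (here refl , Ry)
  ... | false with firstSat-column R C c Y Z tail Cc Rj
  ...   | h , eq , inj₁ (h∈Y , Rh) = h , eq , inj₁ (there h∈Y , Rh)
  ...   | h , eq , inj₂ (h≡j , noneBefore) = h , eq , inj₂ (h≡j , none)
    where
    none : ∀ x → x ∈ y ∷ Y → R x ≡ false
    none x (here refl) = Ry
    none x (there x∈Y) = noneBefore x x∈Y

  cells-offBox : ∀ R C pre → (∀ e → e ∈ pre → C (proj₁ e) ≡ false) → ∀ y → y ∈ cells pre → inBox R C y ≡ false
  cells-offBox R C ((c , P) ∷ pre) off y y∈ with ∈-++⁻ (map (_, c) P) y∈
  ... | inj₁ y∈P with r , _ , refl ← ∈-map⁻ (_, c) y∈P rewrite off (c , P) (here refl) = Boolₚ.∧-zeroʳ (R r)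
  ... | inj₂ y∈pre = cells-offBox R C pre (λ e e∈ → off e (there e∈)) y y∈pre

  pivot-column : ∀ pre c Y Z rest R C → sched ≡ pre ++ (c , Y ++ j ∷ Z) ∷ rest →
    (∀ e → e ∈ pre → C (proj₁ e) ≡ false) → C c ≡ true → R j ≡ true →
    ∃ λ h → pivot R C ≡ (h , c) × ((h ∈ Y × R h ≡ true) ⊎ (h ≡ j × (∀ x → x ∈ Y → R x ≡ false)))
  pivot-column pre c Y Z rest R C refl off Cc Rj =
    let h , eq , where-h = firstSat-column R C c Y Z (cells rest ++ allCells) Cc Rj in h , trans skip eq , where-h
    where
    skip : pivot R C ≡ firstSat (inBox R C) (map (_, c) (Y ++ j ∷ Z) ++ cells rest ++ allCells)
    skip = begin
      firstSat (inBox R C) (cells (pre ++ (c , Y ++ j ∷ Z) ∷ rest) ++ allCells)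
        ≡⟨ cong (λ xs → firstSat (inBox R C) (xs ++ allCells)) (cells-++ pre _) ⟩
      firstSat (inBox R C) ((cells pre ++ cells ((c , Y ++ j ∷ Z) ∷ rest)) ++ allCells)
        ≡⟨ cong (firstSat (inBox R C)) (Listₚ.++-assoc (cells pre) _ allCells) ⟩
      firstSat (inBox R C) (cells pre ++ cells ((c , Y ++ j ∷ Z) ∷ rest) ++ allCells)
        ≡⟨ firstSat-skip (inBox R C) (cells pre) _ (cells-offBox R C pre off) ⟩
      firstSat (inBox R C) ((map (_, c) (Y ++ j ∷ Z) ++ cells rest) ++ allCells)
        ≡⟨ cong (firstSat (inBox R C)) (Listₚ.++-assoc (map (_, c) (Y ++ j ∷ Z)) (cells rest) allCells) ⟩
      firstSat (inBox R C) (map (_, c) (Y ++ j ∷ Z) ++ cells rest ++ allCells)  ∎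
      where open ≡-Reasoning

  restrictedTo : List (Fin d) → Fin d → ℕ
  restrictedTo cs m = if m ∈ᵇ cs then vj m else 0

  -- Starting from rows {j} ∪ S and the columns of rest, pulling reaches the
  -- j-th unmixed simplex with position vj on these columns.
  RealizedFrom : Schedule n d → Sub n → Set
  RealizedFrom [] S = ∀ x → S x ≡ false
  RealizedFrom rest@(_ ∷ _) S = ∀ a b R C →
    (∀ x → R x ≡ (x ≡ᵇ j ∨ S x)) → (∀ m → C m ≡ (m ∈ᵇ columns rest)) → Sized a b R C →
    Any (λ σ → UnmixedIn σ R C (restrictedTo (columns rest))) (triang a b R C)

  -- In column c the rows of Sin met before j are deleted: exactly vj c of them.
  record ColumnStep (Y : List (Fin n)) (c : Fin d) (Sin Sout : Sub n) : Set where
    field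
      j∉Y : ∀ x → x ∈ Y → ¬ x ≡ j
      Sout∩Y : ∀ x → x ∈ Y → Sout x ≡ false
      Sout⊆Sin : Sout ⊆ₛ Sin
      Sin─Sout⊆Y : ∀ x → Sin x ≡ true → Sout x ≡ false → x ∈ Y
      count-Sin : count Sin ≡ vj c + count Sout

  module _ (pre : Schedule n d) (c : Fin d) (Y Z : List (Fin n)) (rest : Schedule n d) (Sin Sout : Sub n)
           (split : sched ≡ pre ++ (c , Y ++ j ∷ Z) ∷ rest)
           (pre-disjoint : ∀ e → e ∈ pre → ¬ proj₁ e ∈ c ∷ columns rest)
           (c∉rest : ¬ c ∈ columns rest)
           (step : ColumnStep Y c Sin Sout) (next : RealizedFrom rest Sout) where

    open ColumnStep step

    withColumn : ℕ → Fin d → ℕ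
    withColumn k m = if m ≡ᵇ c then k else restrictedTo (columns rest) m

    -- With no row of column c left before j, the pivot is (j , c) and pulling moves on to rest.
    leaveColumn : ∀ rs → rs ≡ rest → ∀ a b R C →
      (∀ x → R x ≡ (x ≡ᵇ j ∨ Sout x)) → (∀ m → C m ≡ (m ∈ᵇ c ∷ columns rest)) → Sized a b R C →
      pivot R C ≡ (j , c) → Any (λ σ → UnmixedIn σ R C (withColumn 0)) (triang a b R C)
    leaveColumn [] refl zero zero R C _ _ sz eq = Any.map (UnmixedIn-pos zeros) (unmixed-base R C c sz eq)
      where
      zeros : ∀ m → 0 ≡ withColumn 0 m
      zeros m with m ≡ᵇ c
      ... | true  = refl
      ... | false = refl
    leaveColumn [] refl (suc a) b R C R≗ _ sz eq =
      let x , Rx , x≢j = count≥2⇒other R (proj₁ sz) (proj₁ (pivot∈box sz eq)) in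
      ⊥-elim (false≢true (trans (sym (trans (R≗ x) (cong₂ _∨_ (≢⇒≡ᵇ-false x≢j) (next x)))) Rx))
    leaveColumn [] refl zero (suc b) R C _ C≗ sz eq =
      let m , Cm , m≢c = count≥2⇒other C (proj₂ sz) (proj₂ (pivot∈box sz eq)) in
      ⊥-elim (false≢true (trans (sym (trans (C≗ m) (trans (Boolₚ.∨-identityʳ (m ≡ᵇ c)) (≢⇒≡ᵇ-false m≢c)))) Cm))
    leaveColumn ((c′ , _) ∷ rest′) refl a zero R C _ C≗ sz eq =
      ⊥-elim (c∉rest (here (count≡1⇒unique C (proj₂ sz) Cc′ (proj₂ (pivot∈box sz eq)))))
      where Cc′ = trans (C≗ c′) (∨-trueʳ (c′ ≡ᵇ c) (∈ᵇ-head c′ (columns rest′)))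
    leaveColumn (_ ∷ _) refl a (suc b) R C R≗ C≗ sz eq =
      unmixed-colStep a b R C c (withColumn 0) eq
        (Any.map (UnmixedIn-pos c-unused) (next a b R (C ─ c) R≗ C─c≗ (Sized-─col sz (proj₂ (pivot∈box sz eq)))))
      where
      C─c≗ : ∀ m → (C ─ c) m ≡ (m ∈ᵇ columns rest)
      C─c≗ m with toSum (m ≟ c)
      ... | inj₁ refl = trans (─-self C m) (sym (∉⇒∈ᵇ-false (columns rest) c∉rest))
      ... | inj₂ m≢c rewrite ─-other C m≢c | C≗ m | ≢⇒≡ᵇ-false m≢c = refl
      c-unused : ∀ m → restrictedTo (columns rest) m ≡ withColumn 0 m
      c-unused m with toSum (m ≟ c)
      ... | inj₁ refl rewrite ≡ᵇ-refl m | ∉⇒∈ᵇ-false (columns rest) c∉rest = refl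
      ... | inj₂ m≢c rewrite ≢⇒≡ᵇ-false m≢c = refl

    -- X: the rows of this column still to be deleted before the pivot reaches j.
    deletingBeforeJ : ∀ k X → count X ≡ k → X ⊆ₛ (λ x → Sin x ∧ not (Sout x)) →
      ∀ a b R C → (∀ x → R x ≡ (x ≡ᵇ j ∨ Sout x ∨ X x)) → (∀ m → C m ≡ (m ∈ᵇ c ∷ columns rest)) → Sized a b R C →
      Any (λ σ → UnmixedIn σ R C (withColumn k)) (triang a b R C)
    deletingBeforeJ k X #X X⊆ a b R C R≗ C≗ sz
      with pivot-column pre c Y Z rest R C split
             (λ e e∈ → trans (C≗ (proj₁ e)) (∉⇒∈ᵇ-false (c ∷ columns rest) (pre-disjoint e e∈)))
             (trans (C≗ c) (∈ᵇ-head c (columns rest))) (trans (R≗ j) (cong (_∨ _) (≡ᵇ-refl j)))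
    ... | h , eq , inj₁ (h∈Y , Rh) = deleteRow k a #X sz
      where
      Xh : X h ≡ true
      Xh = ∨-resolve (≢⇒≡ᵇ-false (j∉Y h h∈Y)) (Sout∩Y h h∈Y) (trans (sym (R≗ h)) Rh)
      deleteRow : ∀ k a → count X ≡ k → Sized a b R C → Any (λ σ → UnmixedIn σ R C (withColumn k)) (triang a b R C)
      deleteRow zero _ #X _ = ⊥-elim (false≢true (trans (sym (count≡0⇒empty X #X h)) Xh))
      deleteRow (suc k) zero _ sz =
        ⊥-elim (j∉Y h h∈Y (count≡1⇒unique R (proj₁ sz) (trans (R≗ j) (cong (_∨ _) (≡ᵇ-refl j))) Rh))
      deleteRow (suc k) (suc a) #X sz =
        Any.map (UnmixedIn-pos one-more)
          (unmixed-rowStep a b R C h c (withColumn k) sz eq (j∉Y h h∈Y)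
            (deletingBeforeJ k (X ─ h) (ℕₚ.suc-injective (trans (sym (count-─ X h Xh)) #X))
              (λ x e → X⊆ x (─-⊆ X h x e)) a b (R ─ h) C R─h≗ C≗ (Sized-─row sz Rh)))
        where
        one-more : ∀ m → withColumn k m + 𝟙 (m ≡ᵇ c) ≡ withColumn (suc k) m
        one-more m with m ≡ᵇ c
        ... | true  = ℕₚ.+-comm k 1
        ... | false = ℕₚ.+-identityʳ _
        R─h≗ : ∀ x → (R ─ h) x ≡ (x ≡ᵇ j ∨ Sout x ∨ (X ─ h) x)
        R─h≗ x with toSum (x ≟ h)
        ... | inj₁ refl rewrite ─-self R x | ─-self X x | ≢⇒≡ᵇ-false (j∉Y x h∈Y) | Sout∩Y x h∈Y = refl
        ... | inj₂ x≢h rewrite ─-other R x≢h | ─-other X x≢h = R≗ x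
    ... | h , eq , inj₂ (refl , noneBefore) = reachJ k #X
      where
      reachJ : ∀ k → count X ≡ k → Any (λ σ → UnmixedIn σ R C (withColumn k)) (triang a b R C)
      reachJ zero #X = leaveColumn rest refl a b R C R≗′ C≗ sz eq
        where
        R≗′ : ∀ x → R x ≡ (x ≡ᵇ j ∨ Sout x)
        R≗′ x rewrite R≗ x | count≡0⇒empty X #X x | Boolₚ.∨-identityʳ (Sout x) = refl
      reachJ (suc k) #X =
        let x , Xx = count≡suc⇒inhabited X #X
            Sinx = ∧-trueˡ (X⊆ x Xx)
            Soutx = Boolₚ.not-injective (∧-trueʳ (X⊆ x Xx))
        in ⊥-elim (false≢true (trans (sym (noneBefore x (Sin─Sout⊆Y x Sinx Soutx)))
                                     (trans (R≗ x) (∨-trueʳ (x ≡ᵇ j) (∨-trueʳ (Sout x) Xx)))))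

    column-realized : RealizedFrom ((c , Y ++ j ∷ Z) ∷ rest) Sin
    column-realized a b R C R≗ C≗ sz =
      Any.map (UnmixedIn-pos all-deleted) (deletingBeforeJ (vj c) X #X (λ _ e → e) a b R C R≗′ C≗ sz)
      where
      X : Sub n
      X x = Sin x ∧ not (Sout x)
      Sin≗ : ∀ x → Sin x ≡ (Sout x ∨ X x)
      Sin≗ x with Sout x in Soutx
      ... | true  = Sout⊆Sin x Soutx
      ... | false = sym (Boolₚ.∧-identityʳ (Sin x))
      #X : count X ≡ vj c
      #X = ℕₚ.+-cancelˡ-≡ (count Sout) _ _ (begin
        count Sout + count X                        ≡⟨ cong (_+ count X) (count-cong Sin∧Sout≗) ⟨
        count (λ x → Sin x ∧ Sout x) + count X      ≡⟨ count-partition Sin Sout ⟨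
        count Sin                                   ≡⟨ count-Sin ⟩
        vj c + count Sout                           ≡⟨ ℕₚ.+-comm (vj c) _ ⟩
        count Sout + vj c                           ∎)
        where
        open ≡-Reasoning
        Sin∧Sout≗ : ∀ x → (Sin x ∧ Sout x) ≡ Sout x
        Sin∧Sout≗ x with Sout x in Soutx
        ... | true  rewrite Sout⊆Sin x Soutx = refl
        ... | false = Boolₚ.∧-zeroʳ (Sin x)
      R≗′ : ∀ x → R x ≡ (x ≡ᵇ j ∨ Sout x ∨ X x)
      R≗′ x = trans (R≗ x) (cong (x ≡ᵇ j ∨_) (Sin≗ x))
      all-deleted : ∀ m → withColumn (vj c) m ≡ restrictedTo (c ∷ columns rest) m
      all-deleted m with toSum (m ≟ c)
      ... | inj₁ refl rewrite ≡ᵇ-refl m = refl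
      ... | inj₂ m≢c rewrite ≢⇒≡ᵇ-false m≢c = refl

-- i-spread systems

foldr⊓≤init : ∀ a as → foldr ℕ._⊓_ a as ≤ a
foldr⊓≤init a [] = ℕₚ.≤-refl
foldr⊓≤init a (b ∷ bs) = ℕₚ.≤-trans (ℕₚ.m⊓n≤n b _) (foldr⊓≤init a bs)

minList≤ : ∀ l {z} → z ∈ l → minList l ≤ z
minList≤ (a ∷ as) (here refl) = foldr⊓≤init a as
minList≤ (a ∷ as) {z} (there z∈as) = go as z∈as
  where
  go : ∀ bs → z ∈ bs → foldr ℕ._⊓_ a bs ≤ z
  go (b ∷ bs) (here refl) = ℕₚ.m⊓n≤m b _
  go (b ∷ bs) (there z∈bs) = ℕₚ.≤-trans (ℕₚ.m⊓n≤n b _) (go bs z∈bs)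

∣∣≡count : ∀ {k} (S : Subset k) → ∣ S ∣ ≡ count (λ x → does (x ∈? S))
∣∣≡count [] = refl
∣∣≡count (true ∷ S) = cong suc (∣∣≡count S)
∣∣≡count (false ∷ S) = ∣∣≡count S

module SpreadSystem (n′ d′ : ℕ) (i : Fin (suc d′)) (v : Fin (suc n′) → Fin (suc d′) → ℕ)
  (sum≡ : ∀ j → sumℕ (v j) ≡ n′) (spread : ∀ t → t < suc n′ → ∃ λ j → v j i ≡ t) where

  ρ : Fin (suc n′) → ℕ
  ρ j = v j i

  ρ≤n′ : ∀ j → ρ j ≤ n′
  ρ≤n′ j = subst (ρ j ≤_) (trans (sym (sumℕ-extract (v j) i)) (sum≡ j)) (ℕₚ.m≤m+n (ρ j) _)

  rowAt : ℕ → Fin (suc n′)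
  rowAt t with t ≤? n′
  ... | yes t≤n′ = proj₁ (spread t (s≤s t≤n′))
  ... | no _ = zero

  ρ-rowAt : ∀ {t} → t ≤ n′ → ρ (rowAt t) ≡ t
  ρ-rowAt {t} t≤n′ with t ≤? n′
  ... | yes t≤n′ = proj₂ (spread t (s≤s t≤n′))
  ... | no t≰n′ = ⊥-elim (t≰n′ t≤n′)

  -- Pigeonhole: t ↦ rowAt t is injective on 0 … n′, hence hits every row.
  rowAt-surjective : ∀ x → ∃ λ t → t ≤ n′ × rowAt t ≡ x
  rowAt-surjective x with Finₚ.any? (λ t → rowAt (toℕ t) ≟ x)
  ... | yes (t , eq) = toℕ t , ℕ.s≤s⁻¹ (Finₚ.toℕ<n t) , eq
  ... | no missed = ⊥-elim (ℕₚ.<-irrefl refl (Finₚ.injective⇒≤ {f = skip} skip-injective))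
    where
    x≢ : ∀ t → ¬ x ≡ rowAt (toℕ t)
    x≢ t x≡ = missed (t , sym x≡)
    skip : Fin (suc n′) → Fin n′
    skip t = punchOut (x≢ t)
    skip-injective : ∀ {t t′} → skip t ≡ skip t′ → t ≡ t′
    skip-injective {t} {t′} eq = Finₚ.toℕ-injective (begin
      toℕ t              ≡⟨ ρ-rowAt (ℕ.s≤s⁻¹ (Finₚ.toℕ<n t)) ⟨
      ρ (rowAt (toℕ t))  ≡⟨ cong ρ (Finₚ.punchOut-injective (x≢ t) (x≢ t′) eq) ⟩
      ρ (rowAt (toℕ t′)) ≡⟨ ρ-rowAt (ℕ.s≤s⁻¹ (Finₚ.toℕ<n t′)) ⟩
      toℕ t′             ∎)
      where open ≡-Reasoning

  ρ-injective : ∀ {x y} → ρ x ≡ ρ y → x ≡ y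
  ρ-injective {x} {y} ρx≡ρy
    with t , t≤ , refl ← rowAt-surjective x
    with t′ , t′≤ , refl ← rowAt-surjective y
    = cong rowAt (trans (sym (ρ-rowAt t≤)) (trans ρx≡ρy (ρ-rowAt t′≤)))

  rowAt-ρ : ∀ x → rowAt (ρ x) ≡ x
  rowAt-ρ x = ρ-injective (ρ-rowAt (ρ≤n′ x))

  atLeast : ℕ → Sub (suc n′)
  atLeast s x = does (s ≤? ρ x)

  count-atLeast : ∀ k s → s + k ≡ suc n′ → count (atLeast s) ≡ k
  count-atLeast zero s s+0≡n = sumℕ-zero _ (λ x → cong 𝟙 (dec-false (s ≤? ρ x) (ℕₚ.<⇒≱ (ρ<s x))))
    where
    ρ<s : ∀ x → ρ x < s
    ρ<s x = subst (ρ x <_) (trans (sym s+0≡n) (ℕₚ.+-identityʳ s)) (s≤s (ρ≤n′ x))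
  count-atLeast (suc k) s s+k≡n =
    trans (count-─ (atLeast s) x₀ (dec-true (s ≤? ρ x₀) (ℕₚ.≤-reflexive (sym ρx₀))))
          (cong suc (trans (count-cong shift) (count-atLeast k (suc s) (trans (sym (ℕₚ.+-suc s k)) s+k≡n))))
    where
    s≤n′ : s ≤ n′
    s≤n′ = subst (s ≤_) (ℕₚ.suc-injective (trans (sym (ℕₚ.+-suc s k)) s+k≡n)) (ℕₚ.m≤m+n s k)
    x₀ = rowAt s
    ρx₀ : ρ x₀ ≡ s
    ρx₀ = ρ-rowAt s≤n′
    shift : ∀ x → (atLeast s ─ x₀) x ≡ atLeast (suc s) x
    shift x with toSum (x ≟ x₀)
    ... | inj₁ refl = trans (─-self (atLeast s) x)
                        (sym (dec-false (suc s ≤? ρ x) (ℕₚ.<-irrefl (sym ρx₀))))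
    ... | inj₂ x≢x₀ = trans (─-other (atLeast s) x≢x₀) (step (s ≤? ρ x))
      where
      step : Dec (s ≤ ρ x) → atLeast s x ≡ atLeast (suc s) x
      step (yes s≤ρx) = trans (dec-true (s ≤? ρ x) s≤ρx) (sym (dec-true (suc s ≤? ρ x)
        (ℕₚ.≤∧≢⇒< s≤ρx (λ s≡ρx → x≢x₀ (ρ-injective (trans (sym s≡ρx) (sym ρx₀)))))))
      step (no s≰ρx) = trans (dec-false (s ≤? ρ x) s≰ρx) (sym (dec-false (suc s ≤? ρ x) (λ s<ρx → s≰ρx (ℕₚ.<⇒≤ s<ρx))))

  above : ℕ → Sub (suc n′)
  above t = atLeast (suc t)

  count-above : ∀ t → t ≤ n′ → count (above t) ≡ n′ ∸ t
  count-above t t≤n′ = count-atLeast (n′ ∸ t) (suc t) (cong suc (ℕₚ.m+[n∸m]≡n t≤n′))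

  above⇒< : ∀ {t x} → above t x ≡ true → t < ρ x
  above⇒< {t} {x} = does-true⇒ (suc t ≤? ρ x)

  <⇒above : ∀ {t x} → t < ρ x → above t x ≡ true
  <⇒above {t} {x} = dec-true (suc t ≤? ρ x)

  ¬above⇒≤ : ∀ {t x} → above t x ≡ false → ρ x ≤ t
  ¬above⇒≤ {t} {x} e = ℕₚ.≮⇒≥ (does-false⇒ (suc t ≤? ρ x) e)

  ≤⇒¬above : ∀ {t x} → ρ x ≤ t → above t x ≡ false
  ≤⇒¬above {t} {x} ρx≤t = dec-false (suc t ≤? ρ x) (ℕₚ.≤⇒≯ ρx≤t)

  others : Fin (suc n′) → Sub (suc n′)
  others j x = not (x ≡ᵇ j)

  count-others : ∀ j → count (others j) ≡ n′
  count-others j = ℕₚ.suc-injective (begin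
    suc (count (others j))                 ≡⟨ cong suc (count-cong (λ x → sym (all─j x))) ⟩
    suc (count (full ─ j))                 ≡⟨ count-─ full j refl ⟨
    count (full {suc n′})                  ≡⟨ count-full (suc n′) ⟩
    suc n′                                 ∎)
    where
    open ≡-Reasoning
    all─j : ∀ x → (full ─ j) x ≡ others j x
    all─j x with x ≡ᵇ j
    ... | true  = refl
    ... | false = refl

  rowsFrom : ℕ → ℕ → List (Fin (suc n′))
  rowsFrom t zero = []
  rowsFrom t (suc k) = rowAt t ∷ rowsFrom (suc t) k

  rowsFrom-+ : ∀ t a b → rowsFrom t (a + b) ≡ rowsFrom t a ++ rowsFrom (t + a) b
  rowsFrom-+ t zero b = cong (λ s → rowsFrom s b) (sym (ℕₚ.+-identityʳ t))
  rowsFrom-+ t (suc a) b =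
    cong (rowAt t ∷_) (trans (rowsFrom-+ (suc t) a b)
      (cong (λ s → rowsFrom (suc t) a ++ rowsFrom s b) (sym (ℕₚ.+-suc t a))))

  ∈-rowsFrom⁻ : ∀ t k {y} → t + k ≤ suc n′ → y ∈ rowsFrom t k → t ≤ ρ y × ρ y < t + k
  ∈-rowsFrom⁻ t (suc k) t+k≤n (here refl) =
    ℕₚ.≤-reflexive (sym ρt) , subst (_< t + suc k) (sym ρt) (ℕₚ.m<m+n t (s≤s z≤n))
    where ρt = ρ-rowAt (ℕ.s≤s⁻¹ (ℕₚ.≤-trans (ℕₚ.m<m+n t (s≤s z≤n)) t+k≤n))
  ∈-rowsFrom⁻ t (suc k) {y} t+k≤n (there y∈) =
    let t<ρy , ρy< = ∈-rowsFrom⁻ (suc t) k (subst (_≤ suc n′) (ℕₚ.+-suc t k) t+k≤n) y∈ in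
    ℕₚ.<⇒≤ t<ρy , subst (ρ y <_) (sym (ℕₚ.+-suc t k)) ρy<

  ∈-rowsFrom⁺ : ∀ t k {y} → t ≤ ρ y → ρ y < t + k → y ∈ rowsFrom t k
  ∈-rowsFrom⁺ t zero t≤ρy ρy<t+0 = ⊥-elim (ℕₚ.<⇒≱ (subst (_ <_) (ℕₚ.+-identityʳ t) ρy<t+0) t≤ρy)
  ∈-rowsFrom⁺ t (suc k) {y} t≤ρy ρy< with ℕₚ.m≤n⇒m<n∨m≡n t≤ρy
  ... | inj₁ t<ρy = there (∈-rowsFrom⁺ (suc t) k t<ρy (subst (ρ y <_) (ℕₚ.+-suc t k) ρy<))
  ... | inj₂ refl = here (sym (rowAt-ρ y))

  byRank : List (Fin (suc n′))
  byRank = rowsFrom 0 (suc n′)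

  below above-list : Fin (suc n′) → List (Fin (suc n′))
  below j = rowsFrom 0 (ρ j)
  above-list j = rowsFrom (suc (ρ j)) (n′ ∸ ρ j)

  byRank-split : ∀ j → byRank ≡ below j ++ j ∷ above-list j
  byRank-split j = begin
    rowsFrom 0 (suc n′)                       ≡⟨ cong (rowsFrom 0) n≡ ⟩
    rowsFrom 0 (ρ j + suc (n′ ∸ ρ j))         ≡⟨ rowsFrom-+ 0 (ρ j) (suc (n′ ∸ ρ j)) ⟩
    below j ++ rowAt (ρ j) ∷ above-list j     ≡⟨ cong (λ x → below j ++ x ∷ above-list j) (rowAt-ρ j) ⟩
    below j ++ j ∷ above-list j               ∎
    where
    open ≡-Reasoning
    n≡ : suc n′ ≡ ρ j + suc (n′ ∸ ρ j)
    n≡ = sym (trans (ℕₚ.+-suc (ρ j) _) (cong suc (ℕₚ.m+[n∸m]≡n (ρ≤n′ j))))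

  ∈-below⁻ : ∀ j {y} → y ∈ below j → ρ y < ρ j
  ∈-below⁻ j y∈ = proj₂ (∈-rowsFrom⁻ 0 (ρ j) (ℕₚ.m≤n⇒m≤1+n (ρ≤n′ j)) y∈)

  ∈-below⁺ : ∀ j {y} → ρ y < ρ j → y ∈ below j
  ∈-below⁺ j ρy<ρj = ∈-rowsFrom⁺ 0 (ρ j) z≤n ρy<ρj

  ∈-above-list⁻ : ∀ j {y} → y ∈ above-list j → above (ρ j) y ≡ true
  ∈-above-list⁻ j y∈ =
    <⇒above (proj₁ (∈-rowsFrom⁻ (suc (ρ j)) (n′ ∸ ρ j) (ℕₚ.≤-reflexive (cong suc (ℕₚ.m+[n∸m]≡n (ρ≤n′ j)))) y∈))

  ∈-above-list⁺ : ∀ j {y} → above (ρ j) y ≡ true → y ∈ above-list j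
  ∈-above-list⁺ j {y} e = ∈-rowsFrom⁺ (suc (ρ j)) (n′ ∸ ρ j) (above⇒< e)
    (subst (ρ y <_) (sym (cong suc (ℕₚ.m+[n∸m]≡n (ρ≤n′ j)))) (s≤s (ρ≤n′ y)))

  minimum≤ : ∀ S m {y} → y FS.∈ S → minList (valuesOn S (λ j → v j m)) ≤ v y m
  minimum≤ S m y∈S = minList≤ (valuesOn S (λ j → v j m)) (∈-map⁺ (λ j → v j m) (∈-filter⁺ (_∈? S) (∈-allFin _) y∈S))

  -- Outside column i the minima are bounded by the coordinates of y, whose sum there is n′ ∸ ρ y.
  minima-sum≤ : ∀ S {y} → y FS.∈ S →
    sumℕ (λ m → minList (valuesOn S (λ j → v j m))) ≤ minList (valuesOn S (λ j → v j i)) + (n′ ∸ ρ y)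
  minima-sum≤ S {y} y∈S =
    subst (_≤ mn i + (n′ ∸ ρ y)) (sym (sumℕ-extract mn i))
      (ℕₚ.+-monoʳ-≤ (mn i) (subst (sumℕ (λ m → if m ≡ᵇ i then 0 else mn m) ≤_) rest-y (sumℕ-mono offColumn)))
    where
    mn : Fin (suc d′) → ℕ
    mn m = minList (valuesOn S (λ j → v j m))
    rest-y : sumℕ (λ m → if m ≡ᵇ i then 0 else v y m) ≡ n′ ∸ ρ y
    rest-y = sym (trans (cong (_∸ ρ y) (trans (sym (sum≡ y)) (sumℕ-extract (v y) i))) (ℕₚ.m+n∸m≡n (ρ y) _))
    offColumn : ∀ m → (if m ≡ᵇ i then 0 else mn m) ≤ (if m ≡ᵇ i then 0 else v y m)
    offColumn m with m ≡ᵇ i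
    ... | true  = z≤n
    ... | false = minimum≤ S m y∈S

  window : ℕ → ℕ → Sub (suc n′)
  window μ M x = atLeast μ x ∧ not (above M x)

  count-window : ∀ {μ M} → μ ≤ M → M ≤ n′ → (n′ ∸ M) + count (window μ M) ≡ suc n′ ∸ μ
  count-window {μ} {M} μ≤M M≤n′ = begin
    (n′ ∸ M) + count (window μ M)                         ≡⟨ cong (_+ count (window μ M)) (count-above M M≤n′) ⟨
    count (above M) + count (window μ M)                  ≡⟨ cong (_+ count (window μ M)) (count-cong aboveM) ⟨
    count (λ x → atLeast μ x ∧ above M x) + count (window μ M) ≡⟨ count-partition (atLeast μ) (above M) ⟨
    count (atLeast μ)                                     ≡⟨ count-atLeast (suc n′ ∸ μ) μ (ℕₚ.m+[n∸m]≡n μ≤n) ⟩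
    suc n′ ∸ μ                                             ∎
    where
    open ≡-Reasoning
    μ≤n = ℕₚ.≤-trans μ≤M (ℕₚ.m≤n⇒m≤1+n M≤n′)
    aboveM : ∀ x → (atLeast μ x ∧ above M x) ≡ above M x
    aboveM x with above M x in a
    ... | true rewrite dec-true (μ ≤? ρ x) (ℕₚ.≤-trans μ≤M (ℕₚ.<⇒≤ (above⇒< a))) = refl
    ... | false = Boolₚ.∧-zeroʳ (atLeast μ x)

  spreadOut : SpreadOut v
  spreadOut S (x₀ , x₀∈S) = ℕₚ.≤-trans (minima-sum≤ S jmax∈S) (ℕₚ.m+n≤o⇒m≤o∸n (μ + (n′ ∸ M)) (begin
      μ + (n′ ∸ M) + ∣ S ∣               ≡⟨ ℕₚ.+-assoc μ _ _ ⟩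
      μ + ((n′ ∸ M) + ∣ S ∣)             ≤⟨ ℕₚ.+-monoʳ-≤ μ (ℕₚ.+-monoʳ-≤ (n′ ∸ M) ∣S∣≤window) ⟩
      μ + ((n′ ∸ M) + count (window μ M)) ≡⟨ cong (μ +_) (count-window μ≤M (ρ≤n′ jmax)) ⟩
      μ + (suc n′ ∸ μ)                   ≡⟨ ℕₚ.m+[n∸m]≡n (ℕₚ.≤-trans μ≤M (ℕₚ.m≤n⇒m≤1+n (ρ≤n′ jmax))) ⟩
      suc n′                             ∎))
    where
    open ℕₚ.≤-Reasoning
    members = filter (_∈? S) (allFin (suc n′))
    jmax = argmax ρ x₀ members
    jmax∈S : jmax FS.∈ S
    jmax∈S = argmax-all ρ x₀∈S (All.tabulate (λ y∈ → proj₂ (∈-filter⁻ (_∈? S) {xs = allFin _} y∈)))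
    M = ρ jmax
    μ = minList (valuesOn S (λ j → v j i))
    μ≤M : μ ≤ M
    μ≤M = minimum≤ S i jmax∈S
    S⊆window : (λ x → does (x ∈? S)) ⊆ₛ window μ M
    S⊆window x x∈S = ∧-true (dec-true (μ ≤? ρ x) (minimum≤ S i y∈S))
      (cong not (≤⇒¬above (All.lookup (f[xs]≤f[argmax] {f = ρ} x₀ members) (∈-filter⁺ (_∈? S) (∈-allFin x) y∈S))))
      where y∈S = does-true⇒ (x ∈? S) x∈S
    ∣S∣≤window : ∣ S ∣ ≤ count (window μ M)
    ∣S∣≤window = subst (_≤ count (window μ M)) (sym (∣∣≡count S)) (count-mono S⊆window)

module Insertion {n : ℕ} where

  -- Insert x into P right after u members of S, and return the members of S not passed.
  insert : Sub n → ℕ → Fin n → List (Fin n) → List (Fin n) × Sub n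
  insert S zero    x P = x ∷ P , S
  insert S (suc u) x [] = x ∷ [] , S
  insert S (suc u) x (y ∷ P) with S y
  ... | true  = map₁ (y ∷_) (insert (S ─ y) u x P)
  ... | false = map₁ (y ∷_) (insert S (suc u) x P)

  record Inserted (S : Sub n) (x : Fin n) (P : List (Fin n)) (out : List (Fin n) × Sub n) : Set where
    field
      passed later : List (Fin n)
      split : P ≡ passed ++ later
      result : proj₁ out ≡ passed ++ x ∷ later
      passed-removed : ∀ y → y ∈ passed → proj₂ out y ≡ false
      out⊆S : proj₂ out ⊆ₛ S
      S─out⊆passed : ∀ y → S y ≡ true → proj₂ out y ≡ false → y ∈ passed

  insert-shape : ∀ S u x P → Inserted S x P (insert S u x P)
  insert-shape S zero x P = record
    { passed = [] ; later = P ; split = refl ; result = refl ; passed-removed = λ _ ()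
    ; out⊆S = ⊆ₛ-refl ; S─out⊆passed = λ y Sy Sy′ → ⊥-elim (false≢true (trans (sym Sy′) Sy)) }
  insert-shape S (suc u) x [] = record
    { passed = [] ; later = [] ; split = refl ; result = refl ; passed-removed = λ _ ()
    ; out⊆S = ⊆ₛ-refl ; S─out⊆passed = λ y Sy Sy′ → ⊥-elim (false≢true (trans (sym Sy′) Sy)) }
  insert-shape S (suc u) x (y ∷ P) with S y in Sy
  ... | true = record
    { passed = y ∷ passed ; later = later ; split = cong (y ∷_) split ; result = cong (y ∷_) result
    ; passed-removed = removed ; out⊆S = λ z e → ─-⊆ S y z (out⊆S z e) ; S─out⊆passed = S─out }
    where
    open Inserted (insert-shape (S ─ y) u x P)
    out = proj₂ (insert (S ─ y) u x P)
    removed : ∀ z → z ∈ y ∷ passed → out z ≡ false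
    removed z (here refl) with out z in outz
    ... | false = refl
    ... | true = ⊥-elim (false≢true (trans (sym (─-self S z)) (out⊆S z outz)))
    removed z (there z∈) = passed-removed z z∈
    S─out : ∀ z → S z ≡ true → out z ≡ false → z ∈ y ∷ passed
    S─out z Sz outz with toSum (z ≟ y)
    ... | inj₁ refl = here refl
    ... | inj₂ z≢y = there (S─out⊆passed z (trans (─-other S z≢y) Sz) outz)
  ... | false = record
    { passed = y ∷ passed ; later = later ; split = cong (y ∷_) split ; result = cong (y ∷_) result
    ; passed-removed = removed ; out⊆S = out⊆S ; S─out⊆passed = λ z Sz outz → there (S─out⊆passed z Sz outz) }
    where
    open Inserted (insert-shape S (suc u) x P)
    out = proj₂ (insert S (suc u) x P)
    removed : ∀ z → z ∈ y ∷ passed → out z ≡ false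
    removed z (here refl) with out z in outz
    ... | false = refl
    ... | true = ⊥-elim (false≢true (trans (sym Sy) (out⊆S z outz)))
    removed z (there z∈) = passed-removed z z∈

  insert-count : ∀ S u x P → (∀ y → S y ≡ true → y ∈ P) → u ≤ count S →
                 count S ≡ u + count (proj₂ (insert S u x P))
  insert-count S zero x P _ _ = refl
  insert-count S (suc u) x [] S⊆P u<#S with count S in #S
  ... | suc _ = ⊥-elim (case S⊆P _ (proj₂ (count≡suc⇒inhabited S #S)) of λ ())
  insert-count S (suc u) x (y ∷ P) S⊆P u<#S with S y in Sy
  ... | true = trans (count-─ S y Sy) (cong suc (insert-count (S ─ y) u x P S─y⊆P
                 (ℕ.s≤s⁻¹ (subst (suc u ≤_) (count-─ S y Sy) u<#S))))
    where
    S─y⊆P : ∀ z → (S ─ y) z ≡ true → z ∈ P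
    S─y⊆P z e with toSum (z ≟ y) | S⊆P z (─-⊆ S y z e)
    ... | inj₁ refl | _ = ⊥-elim (false≢true (trans (sym (─-self S z)) e))
    ... | inj₂ z≢y | here z≡y = ⊥-elim (z≢y z≡y)
    ... | inj₂ z≢y | there z∈P = z∈P
  ... | false = insert-count S (suc u) x P S⊆P′ u<#S
    where
    S⊆P′ : ∀ z → S z ≡ true → z ∈ P
    S⊆P′ z Sz with S⊆P z Sz
    ... | here refl = ⊥-elim (false≢true (trans (sym Sy) Sz))
    ... | there z∈P = z∈P

  insert-∈⁻ : ∀ S u x P {y} → y ∈ proj₁ (insert S u x P) → y ∈ P ⊎ y ≡ x
  insert-∈⁻ S u x P {y} y∈ = lower (∈-++⁻ passed (subst (y ∈_) result y∈))
    where
    open Inserted (insert-shape S u x P)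
    lower : y ∈ passed ⊎ y ∈ x ∷ later → y ∈ P ⊎ y ≡ x
    lower (inj₁ y∈ys) = inj₁ (subst (y ∈_) (sym split) (∈-++⁺ˡ y∈ys))
    lower (inj₂ (here y≡x)) = inj₂ y≡x
    lower (inj₂ (there y∈zs)) = inj₁ (subst (y ∈_) (sym split) (∈-++⁺ʳ passed y∈zs))

  insert-∈⁺ : ∀ S u x P {y} → y ∈ P → y ∈ proj₁ (insert S u x P)
  insert-∈⁺ S u x P {y} y∈ = subst (y ∈_) (sym result) (lift (∈-++⁻ passed (subst (y ∈_) split y∈)))
    where
    open Inserted (insert-shape S u x P)
    lift : y ∈ passed ⊎ y ∈ later → y ∈ passed ++ x ∷ later
    lift (inj₁ y∈ys) = ∈-++⁺ˡ y∈ys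
    lift (inj₂ y∈zs) = ∈-++⁺ʳ passed (there y∈zs)

  insert-∈-self : ∀ S u x P → x ∈ proj₁ (insert S u x P)
  insert-∈-self S u x P = subst (x ∈_) (sym result) (∈-++⁺ʳ passed (here refl))
    where open Inserted (insert-shape S u x P)

module Realization (n′ d′ : ℕ) (i : Fin (suc d′)) (v : Fin (suc n′) → Fin (suc d′) → ℕ)
  (sum≡ : ∀ j → sumℕ (v j) ≡ n′) (spread : ∀ t → t < suc n′ → ∃ λ j → v j i ≡ t) where

  open SpreadSystem n′ d′ i v sum≡ spread
  open Insertion

  otherColumns : List (Fin (suc d′))
  otherColumns = tabulate (punchIn i)

  -- Rows are inserted from the highest rank down; row x is placed in the c-th list after
  -- v x c of the higher rows it has not passed in earlier columns.
  insertRow : Sub (suc n′) → Fin (suc n′) → Schedule (suc n′) (suc d′) → Schedule (suc n′) (suc d′)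
  insertRow S x [] = []
  insertRow S x ((c , P) ∷ rest) =
    (c , proj₁ (insert S (v x c) x P)) ∷ insertRow (proj₂ (insert S (v x c) x P)) x rest

  addRow : Fin (suc n′) → Schedule (suc n′) (suc d′) → Schedule (suc n′) (suc d′)
  addRow x = insertRow (above (ρ x)) x

  build : List (Fin (suc n′)) → Schedule (suc n′) (suc d′)
  build = foldr addRow (map (_, []) otherColumns)

  schedule : Schedule (suc n′) (suc d′)
  schedule = (i , byRank) ∷ build byRank

  columns-insertRow : ∀ S x sch → columns (insertRow S x sch) ≡ columns sch
  columns-insertRow S x [] = refl
  columns-insertRow S x ((c , P) ∷ rest) = cong (c ∷_) (columns-insertRow _ x rest)

  columns-build : ∀ xs → columns (build xs) ≡ otherColumns
  columns-build [] = empty otherColumns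
    where
    empty : ∀ cs → columns (map (_, []) cs) ≡ cs
    empty [] = refl
    empty (c ∷ cs) = cong (c ∷_) (empty cs)
  columns-build (x ∷ xs) = trans (columns-insertRow _ x (build xs)) (columns-build xs)

  Holds : List (Fin (suc n′)) → Schedule (suc n′) (suc d′) → Set
  Holds xs = All (λ (_ , P) → ∀ y → (y ∈ P → y ∈ xs) × (y ∈ xs → y ∈ P))

  insertRow-Holds : ∀ {xs} S x sch → Holds xs sch → Holds (x ∷ xs) (insertRow S x sch)
  insertRow-Holds S x [] [] = []
  insertRow-Holds S x ((c , P) ∷ rest) (holds ∷ holds-rest) =
    (λ y → sound y , complete y) ∷ insertRow-Holds _ x rest holds-rest
    where
    sound : ∀ y → y ∈ proj₁ (insert S (v x c) x P) → y ∈ x ∷ _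
    sound y y∈ with insert-∈⁻ S (v x c) x P y∈
    ... | inj₁ y∈P = there (proj₁ (holds y) y∈P)
    ... | inj₂ y≡x = here y≡x
    complete : ∀ y → y ∈ x ∷ _ → y ∈ proj₁ (insert S (v x c) x P)
    complete y (here refl) = insert-∈-self S (v x c) x P
    complete y (there y∈) = insert-∈⁺ S (v x c) x P (proj₂ (holds y) y∈)

  build-Holds : ∀ xs → Holds xs (build xs)
  build-Holds [] = empty otherColumns
    where
    empty : ∀ cs → Holds [] (map (_, []) cs)
    empty [] = []
    empty (c ∷ cs) = (λ y → (λ ()) , (λ ())) ∷ empty cs
  build-Holds (x ∷ xs) = insertRow-Holds _ x (build xs) (build-Holds xs)

  module ForRow (j : Fin (suc n′)) where

    open ColumnMajor schedule (zero , zero) j (v j)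

    Form : List (Fin (suc n′)) → List (Fin (suc n′)) → Set
    Form Y₀ P = ∃₂ λ Y Z → P ≡ Y ++ j ∷ Z × (∀ y → y ∈ Y → y ∈ Y₀ ⊎ ρ y < ρ j) × (∀ y → y ∈ Y₀ → y ∈ Y)

    insert-around-j : ∀ x ys zs Y Z → ys ++ zs ≡ Y ++ j ∷ Z →
      ∃₂ λ Y′ Z′ → ys ++ x ∷ zs ≡ Y′ ++ j ∷ Z′ × (∀ y → y ∈ Y′ → y ∈ Y ⊎ y ≡ x) × (∀ y → y ∈ Y → y ∈ Y′)
    insert-around-j x [] zs Y Z eq = x ∷ Y , Z , cong (x ∷_) eq , new , λ _ → there
      where
      new : ∀ y → y ∈ x ∷ Y → y ∈ Y ⊎ y ≡ x
      new y (here y≡x) = inj₂ y≡x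
      new y (there y∈Y) = inj₁ y∈Y
    insert-around-j x (a ∷ ys) zs [] Z eq with refl , _ ← Listₚ.∷-injective eq =
      [] , ys ++ x ∷ zs , refl , (λ _ ()) , (λ _ ())
    insert-around-j x (a ∷ ys) zs (b ∷ Y) Z eq with refl , eq′ ← Listₚ.∷-injective eq =
      let Y′ , Z′ , eq″ , sound , complete = insert-around-j x ys zs Y Z eq′ in
      a ∷ Y′ , Z′ , cong (a ∷_) eq″ , sound′ sound , complete′ complete
      where
      sound′ : ∀ {Y′} → (∀ y → y ∈ Y′ → y ∈ Y ⊎ y ≡ x) → ∀ y → y ∈ a ∷ Y′ → y ∈ a ∷ Y ⊎ y ≡ x
      sound′ _ y (here y≡a) = inj₁ (here y≡a)
      sound′ sound y (there y∈) with sound y y∈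
      ... | inj₁ y∈Y = inj₁ (there y∈Y)
      ... | inj₂ y≡x = inj₂ y≡x
      complete′ : ∀ {Y′} → (∀ y → y ∈ Y → y ∈ Y′) → ∀ y → y ∈ a ∷ Y → y ∈ a ∷ Y′
      complete′ _ y (here y≡a) = here y≡a
      complete′ complete y (there y∈Y) = there (complete y y∈Y)

    Form-insert : ∀ {Y₀ P} S u x → ρ x < ρ j → Form Y₀ P → Form Y₀ (proj₁ (insert S u x P))
    Form-insert {Y₀} {P} S u x ρx<ρj (Y , Z , P≡ , sound , complete) =
      let Y′ , Z′ , eq , sound′ , complete′ = insert-around-j x passed later Y Z (trans (sym split) P≡) in
      Y′ , Z′ , trans result eq , sound″ sound′ , (λ y y∈ → complete′ y (complete y y∈))
      where
      open Inserted (insert-shape S u x P)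
      sound″ : ∀ {Y′} → (∀ y → y ∈ Y′ → y ∈ Y ⊎ y ≡ x) → ∀ y → y ∈ Y′ → y ∈ Y₀ ⊎ ρ y < ρ j
      sound″ sound′ y y∈ with sound′ y y∈
      ... | inj₁ y∈Y = sound y y∈Y
      ... | inj₂ refl = inj₂ ρx<ρj

    Refines : List (Fin (suc n′)) → List (Fin (suc n′)) → Set
    Refines P₀ P = ∀ Y₀ Z₀ → P₀ ≡ Y₀ ++ j ∷ Z₀ → Form Y₀ P

    Refined : Schedule (suc n′) (suc d′) → Schedule (suc n′) (suc d′) → Set
    Refined = Pointwise (λ (c , P₀) (c′ , P) → c ≡ c′ × Refines P₀ P)

    Refined-refl : ∀ sch → Refined sch sch
    Refined-refl [] = []
    Refined-refl ((c , P) ∷ sch) =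
      (refl , λ Y₀ Z₀ eq → Y₀ , Z₀ , eq , (λ _ → inj₁) , (λ _ y∈ → y∈)) ∷ Refined-refl sch

    Refined-insertRow : ∀ {T F} S x → ρ x < ρ j → Refined T F → Refined T (insertRow S x F)
    Refined-insertRow S x ρx<ρj [] = []
    Refined-insertRow {F = (c , P) ∷ F} S x ρx<ρj ((refl , refines) ∷ refined) =
      (refl , λ Y₀ Z₀ eq → Form-insert S (v x c) x ρx<ρj (refines Y₀ Z₀ eq)) ∷ Refined-insertRow _ x ρx<ρj refined

    Refined-lower : ∀ {T F} xs → (∀ x → x ∈ xs → ρ x < ρ j) → Refined T F → Refined T (foldr addRow F xs)
    Refined-lower [] _ refined = refined
    Refined-lower (x ∷ xs) lower refined =
      Refined-insertRow _ x (lower x (here refl)) (Refined-lower xs (λ y y∈ → lower y (there y∈)) refined)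

    -- j's pass through the remaining columns deletes, in column c, the v j c rows it passed
    -- when it was inserted there.
    realizedFromInsertion : ∀ pre H F S → schedule ≡ pre ++ F →
      (∀ e → e ∈ pre → ¬ proj₁ e ∈ columns F) → Unique (columns F) →
      S ⊆ₛ above (ρ j) → Holds (above-list j) H → count S ≡ sum (map (v j) (columns H)) →
      Refined (insertRow S j H) F → RealizedFrom F S
    realizedFromInsertion pre [] [] S _ _ _ _ _ #S [] = count≡0⇒empty S #S
    realizedFromInsertion pre ((c , P) ∷ H) ((c , P′) ∷ F) S sched≡ disjoint (c∉F ∷ unique) S⊆above
                          (holds ∷ holds-H) #S ((refl , refines) ∷ refined) =
      subst (λ Q → RealizedFrom ((c , Q) ∷ F) S) (sym P′≡)
        (column-realized pre c Y Z F S Sout (trans sched≡ (cong (λ Q → pre ++ (c , Q) ∷ F) P′≡))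
          disjoint (All¬⇒¬Any c∉F) step
          (realizedFromInsertion (pre ++ (c , P′) ∷ []) H F Sout (trans sched≡ (sym (Listₚ.++-assoc pre _ F)))
            disjoint′ unique (λ y e → S⊆above y (out⊆S y e)) holds-H #Sout refined))
      where
      open Inserted (insert-shape S (v j c) j P)
      Sout = proj₂ (insert S (v j c) j P)
      form = refines passed later result
      Y = proj₁ form
      Z = proj₁ (proj₂ form)
      P′≡ = proj₁ (proj₂ (proj₂ form))
      Y-sound = proj₁ (proj₂ (proj₂ (proj₂ form)))
      Y-complete = proj₂ (proj₂ (proj₂ (proj₂ form)))
      S⊆P : ∀ y → S y ≡ true → y ∈ P
      S⊆P y Sy = proj₂ (holds y) (∈-above-list⁺ j (S⊆above y Sy))
      #S≡ : count S ≡ v j c + count Sout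
      #S≡ = insert-count S (v j c) j P S⊆P (subst (v j c ≤_) (sym #S) (ℕₚ.m≤m+n (v j c) _))
      #Sout : count Sout ≡ sum (map (v j) (columns H))
      #Sout = ℕₚ.+-cancelˡ-≡ (v j c) _ _ (trans (sym #S≡) #S)
      passed⊆above : ∀ y → y ∈ passed → ρ j < ρ y
      passed⊆above y y∈ =
        above⇒< (∈-above-list⁻ j (proj₁ (holds y) (subst (y ∈_) (sym split) (∈-++⁺ˡ y∈))))
      belowNotOut : ∀ y → ρ y < ρ j → Sout y ≡ false
      belowNotOut y ρy<ρj with Sout y in Souty
      ... | false = refl
      ... | true = ⊥-elim (ℕₚ.<-asym ρy<ρj (above⇒< (S⊆above y (out⊆S y Souty))))
      step : ColumnStep Y c S Sout
      step = record
        { j∉Y = λ y y∈Y y≡j → case Y-sound y y∈Y of λ where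
            (inj₁ y∈ys) → ℕₚ.<-irrefl (cong ρ (sym y≡j)) (passed⊆above y y∈ys)
            (inj₂ ρy<ρj) → ℕₚ.<-irrefl (cong ρ y≡j) ρy<ρj
        ; Sout∩Y = λ y y∈Y → case Y-sound y y∈Y of λ where
            (inj₁ y∈ys) → passed-removed y y∈ys
            (inj₂ ρy<ρj) → belowNotOut y ρy<ρj
        ; Sout⊆Sin = out⊆S
        ; Sin─Sout⊆Y = λ y Sy Souty → Y-complete y (S─out⊆passed y Sy Souty)
        ; count-Sin = #S≡
        }
      disjoint′ : ∀ e → e ∈ pre ++ (c , P′) ∷ [] → ¬ proj₁ e ∈ columns F
      disjoint′ e e∈ with ∈-++⁻ pre e∈
      ... | inj₁ e∈pre = λ e∈F → disjoint e e∈pre (there e∈F)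
      ... | inj₂ (here refl) = All¬⇒¬Any c∉F

    i∉build : ∀ xs → ¬ i ∈ columns (build xs)
    i∉build xs i∈ with k , i≡ ← ∈-tabulate⁻ (subst (i ∈_) (columns-build xs) i∈) = Finₚ.punchInᵢ≢i i k (sym i≡)

    unique-build : ∀ xs → Unique (columns (build xs))
    unique-build xs = subst Unique (sym (columns-build xs)) (Uniqueₚ.tabulate⁺ (Finₚ.punchIn-injective i _ _))

    sum-otherColumns : sum (map (v j) otherColumns) ≡ n′ ∸ ρ j
    sum-otherColumns = begin
      sum (map (v j) (tabulate (punchIn i)))       ≡⟨ cong sum (Listₚ.map-tabulate (punchIn i) (v j)) ⟩
      sum (tabulate (λ k → v j (punchIn i k)))     ≡⟨ sum-tabulate (λ k → v j (punchIn i k)) ⟩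
      sumℕ (λ k → v j (punchIn i k))               ≡⟨ ℕₚ.m+n∸m≡n (ρ j) _ ⟨
      (ρ j + sumℕ (λ k → v j (punchIn i k))) ∸ ρ j ≡⟨ cong (_∸ ρ j) (trans (sym (sumℕ-punchIn (v j) i)) (sum≡ j)) ⟩
      n′ ∸ ρ j                                     ∎
      where open ≡-Reasoning

    firstColumn : ColumnStep (below j) i (others j) (above (ρ j))
    firstColumn = record
      { j∉Y = λ y y∈ y≡j → ℕₚ.<-irrefl (cong ρ y≡j) (∈-below⁻ j y∈)
      ; Sout∩Y = λ y y∈ → ≤⇒¬above (ℕₚ.<⇒≤ (∈-below⁻ j y∈))
      ; Sout⊆Sin = λ x e → cong not (≢⇒≡ᵇ-false (λ x≡j → ℕₚ.<-irrefl (cong ρ (sym x≡j)) (above⇒< e)))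
      ; Sin─Sout⊆Y = λ x others-x ¬above-x → ∈-below⁺ j (ℕₚ.≤∧≢⇒< (¬above⇒≤ ¬above-x)
          (λ ρx≡ρj → false≢true (trans (sym (cong not (≡ᵇ-refl j)))
                                        (subst (λ y → others j y ≡ true) (ρ-injective ρx≡ρj) others-x))))
      ; count-Sin = trans (count-others j)
          (trans (sym (ℕₚ.m+[n∸m]≡n (ρ≤n′ j))) (cong (ρ j +_) (sym (count-above (ρ j) (ρ≤n′ j)))))
      }

    realizedFromStart : RealizedFrom schedule (others j)
    realizedFromStart = subst (λ Q → RealizedFrom ((i , Q) ∷ build byRank) (others j)) (sym (byRank-split j))
      (column-realized [] i (below j) (above-list j) (build byRank) (others j) (above (ρ j))
        (cong (λ Q → (i , Q) ∷ build byRank) (byRank-split j)) (λ _ ()) (i∉build byRank) firstColumn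
        (realizedFromInsertion ((i , byRank) ∷ []) (build (above-list j)) (build byRank) (above (ρ j)) refl
          (λ { _ (here refl) → i∉build byRank }) (unique-build byRank) ⊆ₛ-refl (build-Holds (above-list j))
          (trans (count-above (ρ j) (ρ≤n′ j))
            (sym (trans (cong (λ cs → sum (map (v j) cs)) (columns-build (above-list j))) sum-otherColumns)))
          refined))
      where
      refined : Refined (addRow j (build (above-list j))) (build byRank)
      refined = subst (Refined _)
        (sym (trans (cong build (byRank-split j)) (Listₚ.foldr-++ addRow _ (below j) (j ∷ above-list j))))
        (Refined-lower (below j) (λ x x∈ → ∈-below⁻ j x∈) (Refined-refl _))

  every-column : ∀ m → (m ∈ᵇ columns schedule) ≡ true
  every-column m with toSum (m ≟ i)
  ... | inj₁ refl = ∈ᵇ-head m (columns (build byRank))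
  ... | inj₂ m≢i = ∨-trueʳ (m ≡ᵇ i) (∈⇒∈ᵇ (subst (m ∈_) (sym (columns-build byRank))
                     (subst (_∈ otherColumns) (Finₚ.punchIn-punchOut (m≢i ∘ sym)) (∈-tabulate⁺ _))))

mainTheorem4 : (n d : ℕ) → 1 ≤ n → 1 ≤ d → (i : Fin d) →
    (v : Fin n → Fin d → ℕ) →
    (∀ j → sumℕ (v j) ≡ n ∸ 1) →
    (∀ t → t < n → ∃ λ j → v j i ≡ t) →
    SpreadOut v × Realizable v
mainTheorem4 (suc n′) (suc d′) _ _ i v sum≡ spread =
  spreadOut , pullingTriangulation , isTriangulation , unmixed
  where
  open SpreadSystem n′ d′ i v sum≡ spread using (spreadOut)
  open Realization n′ d′ i v sum≡ spread
  open PullingTriangulation (cells schedule)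
  unmixed : ∀ j → Any (λ σ → Unmixed σ j × (∀ m → unmixedPos σ j m ≡ v j m)) pullingTriangulation
  unmixed j = Any.map (λ (row-j , single , at) →
                         ((λ m → row-j m refl) , (λ k k≢j → single k k≢j refl)) ,
                         (λ m → trans (at m) (if-true (v j m) 0 (every-column m))))
                (realizedFromStart n′ d′ full full (λ x → sym (Boolₚ.∨-inverseʳ (x ≡ᵇ j)))
                   (λ m → sym (every-column m)) sized-full)
    where open ForRow j
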